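{- Let $G=(V,E)$ be a connected simple graph with $|E|-|V|+1=2$. Then $G$ is uniformly dense if and only if $G$ is obtained from three paths identified at their ends, i.e. there are vertices $u,v$ (possibly $u=v$) and three paths from $u$ to $v$ that pairwise share only $u$ and $v$ (a path of length $0$ being allowed when $u=v$) whose union is $G$, and whose lengths, ordered as $L_1\le L_2\le L_3$, satisfy $L_3-L_2\le L_1$.
   Context: For $A\subseteq E$, $\operatorname{rank}(A)=|V|-c(A)$ where $c(A)$ is the number of connected components of $(V,A)$; $\rho(A)=|A|/\operatorname{rank}(A)$ for nonempty $A$. $G$ is uniformly dense if $\rho(A)\le\rho(E)$ for all nonempty $A\subseteq E$. -}

module Defs where

open import Data.Nat using (ℕ; zero; suc; _+_; _*_; _∸_; _≤_)
open import Data.Fin using (Fin; zero; suc; toℕ; fromℕ; inject₁)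
open import Data.Fin.Subset using (Subset; _∈_; ⊤; ∣_∣; Nonempty)
open import Data.Product using (Σ; ∃; _×_; _,_; proj₁; proj₂)
open import Data.Sum using (_⊎_; inj₁; inj₂)
open import Relation.Binary.PropositionalEquality using (_≡_; _≢_)
open import Relation.Nullary using (¬_)
open import Function.Bundles using (_⇔_)

record Graph : Set where
  field
    n    : ℕ
    m    : ℕ
    ends : Fin m → Fin n × Fin n

open Graph public

Joins : (G : Graph) → Fin (m G) → Fin (n G) → Fin (n G) → Set
Joins G i x y =
  (proj₁ (ends G i) ≡ x × proj₂ (ends G i) ≡ y) ⊎
  (proj₁ (ends G i) ≡ y × proj₂ (ends G i) ≡ x)

Simple : Graph → Set
Simple G =
  (∀ i → proj₁ (ends G i) ≢ proj₂ (ends G i)) ×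
  (∀ i j x y → Joins G i x y → Joins G j x y → i ≡ j)

data Conn (G : Graph) (A : Subset (m G)) : Fin (n G) → Fin (n G) → Set where
  here : ∀ {x} → Conn G A x x
  step : ∀ {x z y} (i : Fin (m G)) → i ∈ A → Joins G i x z →
         Conn G A z y → Conn G A x y

Connected : Graph → Set
Connected G = ∀ x y → Conn G ⊤ x y

-- (V, A) has exactly c connected components: there is a surjection from V
-- onto Fin c whose fibres are exactly the connected components.
HasComponents : (G : Graph) → Subset (m G) → ℕ → Set
HasComponents G A c =
  Σ (Fin (n G) → Fin c) λ f →
    (∀ k → ∃ λ x → f x ≡ k) ×
    (∀ x y → (f x ≡ f y) ⇔ Conn G A x y)

-- rank(A) = |V| - c(A), given that c(A) = c
rankWith : Graph → ℕ → ℕ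
rankWith G c = n G ∸ c

-- ρ(A) ≤ ρ(E), i.e. |A| / rank(A) ≤ |E| / rank(E), written with cleared
-- (positive) denominators: |A| * rank(E) ≤ |E| * rank(A).
UniformlyDense : Graph → Set
UniformlyDense G =
  ∀ (A : Subset (m G)) → Nonempty A →
  ∀ cA cE → HasComponents G A cA → HasComponents G ⊤ cE →
  ∣ A ∣ * rankWith G cE ≤ m G * rankWith G cA

EndPos : (L : ℕ) → Fin (suc L) → Set
EndPos L i = (toℕ i ≡ 0) ⊎ (toℕ i ≡ L)

-- a path from u to v of length L: vertices p 0, ..., p L and edges
-- q 0, ..., q (L-1), edge q i joining p i and p (i+1); vertices pairwise
-- distinct except that the two ends may coincide (when u = v).
record Path (G : Graph) (u v : Fin (n G)) : Set where
  field
    len   : ℕ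
    vert  : Fin (suc len) → Fin (n G)
    edge  : Fin len → Fin (m G)
    start : vert zero ≡ u
    stop  : vert (fromℕ len) ≡ v
    joins : ∀ i → Joins G (edge i) (vert (inject₁ i)) (vert (suc i))
    dist  : ∀ i j → vert i ≡ vert j → i ≡ j ⊎ (EndPos len i × EndPos len j)

open Path public

EdgeOf3 : {G : Graph} {u v : Fin (n G)} (P Q R : Path G u v) →
          (Fin (len P) ⊎ Fin (len Q) ⊎ Fin (len R)) → Fin (m G)
EdgeOf3 P Q R (inj₁ i)        = edge P i
EdgeOf3 P Q R (inj₂ (inj₁ i)) = edge Q i
EdgeOf3 P Q R (inj₂ (inj₂ i)) = edge R i

OnPath : {G : Graph} {u v : Fin (n G)} → Fin (n G) → Path G u v → Set
OnPath w P = ∃ λ i → vert P i ≡ w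

ShareOnlyEnds : {G : Graph} {u v : Fin (n G)} → Path G u v → Path G u v → Set
ShareOnlyEnds {u = u} {v} P Q =
  ∀ w → OnPath w P → OnPath w Q → (w ≡ u) ⊎ (w ≡ v)

-- G is the union of three paths from u to v (P, Q, R, listed so that
-- len P ≤ len Q ≤ len R) pairwise sharing only u and v, with
-- L3 - L2 ≤ L1.  "Union is G": every vertex lies on one of the paths and
-- the edges of the three paths are exactly the edges of G, each used once.
ThetaBalanced : Graph → Set
ThetaBalanced G =
  Σ (Fin (n G)) λ u → Σ (Fin (n G)) λ v →
  Σ (Path G u v) λ P → Σ (Path G u v) λ Q → Σ (Path G u v) λ R →
    ShareOnlyEnds P Q × ShareOnlyEnds P R × ShareOnlyEnds Q R ×
    (∀ w → OnPath w P ⊎ OnPath w Q ⊎ OnPath w R) ×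
    (∀ e → ∃ λ k → EdgeOf3 P Q R k ≡ e) ×
    (∀ k k′ → EdgeOf3 P Q R k ≡ EdgeOf3 P Q R k′ → k ≡ k′) ×
    (len P ≤ len Q) × (len Q ≤ len R) ×
    (len R ∸ len Q ≤ len P)

-- With m = n + 1 the density inequality for A reads |A| (n - 1) ≤ (n + 1) (n - c(A)).
--
-- Theta ⇒ dense.  Fix one edge outside A on each of two paths.  Every vertex is
-- A-connected to u or to an endpoint of another edge outside A (walk along its path
-- away from the fixed edge), so c(A) + |A| + (fixed edges outside A) ≤ m + 1.  If two
-- paths miss edges this gives |A| ≤ n - c(A).  If only the path P misses edges, A
-- contains the other two, so c(A) ≤ |P| ≤ m - |P|; this is where L₃ - L₂ ≤ L₁ is used.
--
-- Dense ⇒ theta.  Deleting a bridge would raise the density, so every degree is at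
-- least 2, and by the handshake lemma the excess degrees sum to 2: one vertex of
-- degree 4 or two of degree 3.  The trails from a branch vertex through the vertices
-- of degree 2 give the three paths (one of them trivial when u = v).  Finally, for A
-- the edges of the two shorter paths, c(A) = L₃ and density gives L₃ ≤ L₁ + L₂.

module Submission where

open import Defs
open import Data.Nat using (ℕ; zero; suc; pred; _+_; _*_; _∸_; _≤_; _<_; z≤n; s≤s; _≤?_; _<?_; >-nonZero; ≢-nonZero)
open import Data.Nat.Properties
open import Data.Nat.Tactic.RingSolver using (solve-∀)
open import Data.Fin using (Fin; zero; suc; toℕ; fromℕ; fromℕ<; inject₁; lower₁; splitAt; join)
import Data.Fin as F
open import Data.Fin.Properties using (toℕ-injective; injective⇒≤; toℕ-fromℕ; toℕ-fromℕ<; toℕ-inject₁; toℕ<n; toℕ≤pred[n]; inject₁-lower₁; toℕ-lower₁; splitAt-join; join-splitAt; any?; all?; ¬∀⟶∃¬)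
import Data.Fin.Properties as Finₚ
open import Data.Fin.Permutation using (↔⇒≡)
open import Data.Fin.Subset using (Subset; _∈_; _∉_; ⊤; ∣_∣; ∁; ⁅_⁆; inside; outside)
open import Data.Fin.Subset.Properties using (_∈?_; ∣p∣≤n; ∣∁p∣≡n∸∣p∣; ∣⁅x⁆∣≡1; x∈⁅x⁆; x∈⁅y⁆⇒x≡y; x∈p⇒x∉∁p; x∉p⇒x∈∁p)
open import Data.Vec using (_∷_; tabulate; here; there)
open import Data.Vec.Properties using (lookup∘tabulate; []=⇒lookup; lookup⇒[]=)
open import Data.Bool using (Bool; true; false; _∨_)
open import Data.Maybe using (Maybe; just; nothing)
import Data.Maybe as Maybe
open import Data.Maybe.Properties using (map-injective)
open import Data.Product using (Σ; ∃; _×_; _,_; proj₁; proj₂; uncurry)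
open import Data.Sum using (_⊎_; inj₁; inj₂; [_,_]′; map₂)
open import Data.Sum.Properties using (inj₁-injective; inj₂-injective)
open import Data.Empty using (⊥; ⊥-elim)
open import Relation.Binary.PropositionalEquality
open import Relation.Binary.Definitions using (tri<; tri≈; tri>)
open import Relation.Nullary using (¬_; Dec; yes; no; does; contradiction)
open import Relation.Nullary.Decidable using (_⊎-dec_; _×-dec_; dec-true)
open import Function using (_∘_; case_of_)
open import Function.Bundles using (_⇔_; mk⇔; Equivalence; mk↔ₛ′)
open import Function.Definitions using (Injective)
open import Algebra.Properties.CommutativeMonoid.Sum +-0-commutativeMonoid
  using (sum; sum-cong-≗; ∑-distrib-+; ∑-comm; sum-replicate-zero)


Injection : ∀ {A B : Set} → (A → B) → Set
Injection f = Injective _≡_ _≡_ f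

nth : ∀ {m} (S : Subset m) → Fin ∣ S ∣ → Fin m
nth (inside ∷ S) zero = zero
nth (inside ∷ S) (suc k) = suc (nth S k)
nth (outside ∷ S) k = suc (nth S k)

nth-∈ : ∀ {m} (S : Subset m) k → nth S k ∈ S
nth-∈ (inside ∷ S) zero = here
nth-∈ (inside ∷ S) (suc k) = there (nth-∈ S k)
nth-∈ (outside ∷ S) k = there (nth-∈ S k)

nth-injective : ∀ {m} (S : Subset m) → Injection (nth S)
nth-injective (inside ∷ S) {zero} {zero} _ = refl
nth-injective (inside ∷ S) {suc k} {suc k′} e = cong suc (nth-injective S (Finₚ.suc-injective e))
nth-injective (outside ∷ S) e = nth-injective S (Finₚ.suc-injective e)

nth-surjective : ∀ {m} (S : Subset m) {e} → e ∈ S → ∃ λ k → nth S k ≡ e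
nth-surjective (inside ∷ S) here = zero , refl
nth-surjective (inside ∷ S) (there e∈S) with k , refl ← nth-surjective S e∈S = suc k , refl
nth-surjective (outside ∷ S) (there e∈S) with k , refl ← nth-surjective S e∈S = k , refl

injective⇒≤∣∣ : ∀ {l m} (S : Subset m) (f : Fin l → Fin m) → Injection f → (∀ i → f i ∈ S) → l ≤ ∣ S ∣
injective⇒≤∣∣ S f f-inj f∈S = injective⇒≤ {f = index} λ {i} {j} e →
  f-inj (trans (sym (proj₂ (nth-surjective S (f∈S i)))) (trans (cong (nth S) e) (proj₂ (nth-surjective S (f∈S j)))))
  where index = λ i → proj₁ (nth-surjective S (f∈S i))

split₃ : ∀ a {b c} → Fin (a + (b + c)) → Fin a ⊎ Fin b ⊎ Fin c
split₃ a {b} i = map₂ (splitAt b) (splitAt a i)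

join₃ : ∀ a b c → Fin a ⊎ Fin b ⊎ Fin c → Fin (a + (b + c))
join₃ a b c = join a (b + c) ∘ map₂ (join b c)

split₃-join₃ : ∀ a b c k → split₃ a (join₃ a b c k) ≡ k
split₃-join₃ a b c k rewrite splitAt-join a (b + c) (map₂ (join b c) k) with k
... | inj₁ _ = refl
... | inj₂ k′ = cong inj₂ (splitAt-join b c k′)

join₃-split₃ : ∀ a b c i → join₃ a b c (split₃ a i) ≡ i
join₃-split₃ a b c i with splitAt a i in eq
... | inj₁ x = trans (cong (join a (b + c)) (sym eq)) (join-splitAt a (b + c) i)
... | inj₂ y = trans (cong (λ z → join a (b + c) (inj₂ z)) (join-splitAt b c y))
                     (trans (cong (join a (b + c)) (sym eq)) (join-splitAt a (b + c) i))

injective⇒≤₃ : ∀ {a b c m} (f : Fin a ⊎ Fin b ⊎ Fin c → Fin m) → Injection f → a + (b + c) ≤ m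
injective⇒≤₃ {a} {b} {c} f f-inj = injective⇒≤ {f = f ∘ split₃ a} λ {i} {j} e →
  trans (sym (join₃-split₃ a b c i)) (trans (cong (join₃ a b c) (f-inj e)) (join₃-split₃ a b c j))

bijective⇒≡₃ : ∀ {a b c m} (f : Fin a ⊎ Fin b ⊎ Fin c → Fin m) → Injection f →
               (∀ e → ∃ λ k → f k ≡ e) → a + (b + c) ≡ m
bijective⇒≡₃ {a} {b} {c} f f-inj f-onto = ↔⇒≡ (mk↔ₛ′ (f ∘ split₃ a) (join₃ a b c ∘ section) to∘from from∘to)
  where
  section = λ e → proj₁ (f-onto e)
  to∘from : ∀ e → f (split₃ a (join₃ a b c (section e))) ≡ e
  to∘from e rewrite split₃-join₃ a b c (section e) = proj₂ (f-onto e)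
  from∘to : ∀ i → join₃ a b c (section (f (split₃ a i))) ≡ i
  from∘to i rewrite f-inj (proj₂ (f-onto (f (split₃ a i)))) = join₃-split₃ a b c i

toFin : ∀ {m} → Maybe (Fin m) → Fin (suc m)
toFin nothing = zero
toFin (just e) = suc e

toFin-injective : ∀ {m} → Injection (toFin {m})
toFin-injective {x = nothing} {nothing} _ = refl
toFin-injective {x = just _} {just _} e = cong just (Finₚ.suc-injective e)

toFin≡suc : ∀ {m} (x : Maybe (Fin m)) {e} → toFin x ≡ suc e → x ≡ just e
toFin≡suc (just _) refl = refl

-- labels, members of A and extras are disjoint inside Maybe (Fin m) ≅ Fin (1 + m)
labels+∣A∣+extras≤ : ∀ {m c s} (A : Subset m) (label : Fin c → Maybe (Fin m)) (extra : Fin s → Fin m) →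
  Injection label → Injection extra →
  (∀ k {e} → label k ≡ just e → e ∉ A) → (∀ t → extra t ∉ A) → (∀ k t → label k ≢ just (extra t)) →
  c + (∣ A ∣ + s) ≤ suc m
labels+∣A∣+extras≤ A label extra label-inj extra-inj label∉A extra∉A label≢extra =
  injective⇒≤₃ F F-inj
  where
  F : Fin _ ⊎ Fin ∣ A ∣ ⊎ Fin _ → Fin (suc _)
  F (inj₁ k) = toFin (label k)
  F (inj₂ (inj₁ a)) = suc (nth A a)
  F (inj₂ (inj₂ t)) = suc (extra t)

  label≢member : ∀ k a → F (inj₁ k) ≢ F (inj₂ (inj₁ a))
  label≢member k a e = label∉A k (toFin≡suc (label k) e) (nth-∈ A a)
  label≢extra′ : ∀ k t → F (inj₁ k) ≢ F (inj₂ (inj₂ t))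
  label≢extra′ k t e = label≢extra k t (toFin≡suc (label k) e)
  member≢extra : ∀ a t → F (inj₂ (inj₁ a)) ≢ F (inj₂ (inj₂ t))
  member≢extra a t e = extra∉A t (subst (_∈ A) (Finₚ.suc-injective e) (nth-∈ A a))

  F-inj : Injection F
  F-inj {inj₁ k} {inj₁ k′} e = cong inj₁ (label-inj (toFin-injective e))
  F-inj {inj₂ (inj₁ a)} {inj₂ (inj₁ a′)} e = cong (inj₂ ∘ inj₁) (nth-injective A (Finₚ.suc-injective e))
  F-inj {inj₂ (inj₂ t)} {inj₂ (inj₂ t′)} e = cong (inj₂ ∘ inj₂) (extra-inj (Finₚ.suc-injective e))
  F-inj {inj₁ k} {inj₂ (inj₁ a)} e = contradiction e (label≢member k a)
  F-inj {inj₂ (inj₁ a)} {inj₁ k} e = contradiction (sym e) (label≢member k a)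
  F-inj {inj₁ k} {inj₂ (inj₂ t)} e = contradiction e (label≢extra′ k t)
  F-inj {inj₂ (inj₂ t)} {inj₁ k} e = contradiction (sym e) (label≢extra′ k t)
  F-inj {inj₂ (inj₁ a)} {inj₂ (inj₂ t)} e = contradiction e (member≢extra a t)
  F-inj {inj₂ (inj₂ t)} {inj₂ (inj₁ a)} e = contradiction (sym e) (member≢extra a t)

splitAt-injective : ∀ a {b} → Injection (splitAt a {b})
splitAt-injective a {b} {i} {j} e = trans (sym (join-splitAt a b i)) (trans (cong (join a b) e) (join-splitAt a b j))

injective⊎⇒≤∣∣ : ∀ {a b m} (S : Subset m) (f : Fin a ⊎ Fin b → Fin m) → Injection f → (∀ k → f k ∈ S) → a + b ≤ ∣ S ∣
injective⊎⇒≤∣∣ {a} S f f-inj f∈S = injective⇒≤∣∣ S (f ∘ splitAt a) (splitAt-injective a ∘ f-inj) (f∈S ∘ splitAt a)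

injective⇒onto : ∀ {k} (f : Fin k → Fin k) → Injection f → ∀ y → ∃ λ x → f x ≡ y
injective⇒onto {k} f f-inj y with any? (λ x → f x F.≟ y)
... | yes found = found
... | no missing = contradiction (injective⇒≤ {f = extended} extended-injective) 1+n≰n
  where
  extended : Fin (suc k) → Fin k
  extended zero = y
  extended (suc x) = f x
  extended-injective : Injection extended
  extended-injective {zero} {zero} _ = refl
  extended-injective {zero} {suc x} e = contradiction (x , sym e) missing
  extended-injective {suc x} {zero} e = contradiction (x , e) missing
  extended-injective {suc x} {suc x′} e = cong suc (f-inj e)

Incident : (G : Graph) → Fin (m G) → Fin (n G) → Set
Incident G e x = proj₁ (ends G e) ≡ x ⊎ proj₂ (ends G e) ≡ x

module GraphLemmas (G : Graph) where

  Joins⇒Incidentˡ : ∀ {i x y} → Joins G i x y → Incident G i x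
  Joins⇒Incidentˡ (inj₁ (p , _)) = inj₁ p
  Joins⇒Incidentˡ (inj₂ (_ , q)) = inj₂ q

  Joins⇒Incidentʳ : ∀ {i x y} → Joins G i x y → Incident G i y
  Joins⇒Incidentʳ (inj₁ (_ , q)) = inj₂ q
  Joins⇒Incidentʳ (inj₂ (p , _)) = inj₁ p

  Incident⇒Joins : ∀ {i x} → Incident G i x → ∃ λ y → Joins G i x y
  Incident⇒Joins (inj₁ p) = _ , inj₁ (p , refl)
  Incident⇒Joins (inj₂ q) = _ , inj₂ (refl , q)

  Joins-Incident : ∀ {i x y z} → Joins G i x y → Incident G i z → z ≡ x ⊎ z ≡ y
  Joins-Incident (inj₁ (refl , refl)) (inj₁ r) = inj₁ (sym r)
  Joins-Incident (inj₁ (refl , refl)) (inj₂ r) = inj₂ (sym r)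
  Joins-Incident (inj₂ (refl , refl)) (inj₁ r) = inj₂ (sym r)
  Joins-Incident (inj₂ (refl , refl)) (inj₂ r) = inj₁ (sym r)

  no-loop : (∀ i → proj₁ (ends G i) ≢ proj₂ (ends G i)) → ∀ {e x} → ¬ Joins G e x x
  no-loop loopless {e} (inj₁ (p , q)) = loopless e (trans p (sym q))
  no-loop loopless {e} (inj₂ (p , q)) = loopless e (trans p (sym q))

  Joins-sym : ∀ {i x y} → Joins G i x y → Joins G i y x
  Joins-sym (inj₁ (p , q)) = inj₂ (p , q)
  Joins-sym (inj₂ (p , q)) = inj₁ (p , q)

  Joins-unique : ∀ {i a c x y} → Joins G i a c → Joins G i x y → (a ≡ x × c ≡ y) ⊎ (a ≡ y × c ≡ x)
  Joins-unique (inj₁ (refl , refl)) (inj₁ (p′ , q′)) = inj₁ (p′ , q′)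
  Joins-unique (inj₁ (refl , refl)) (inj₂ (p′ , q′)) = inj₂ (p′ , q′)
  Joins-unique (inj₂ (refl , refl)) (inj₁ (p′ , q′)) = inj₂ (q′ , p′)
  Joins-unique (inj₂ (refl , refl)) (inj₂ (p′ , q′)) = inj₁ (q′ , p′)

  module _ {A : Subset (m G)} where

    ≡⇒Conn : ∀ {x y} → x ≡ y → Conn G A x y
    ≡⇒Conn refl = here

    Conn-trans : ∀ {x y z} → Conn G A x y → Conn G A y z → Conn G A x z
    Conn-trans here q = q
    Conn-trans (step i i∈A j p) q = step i i∈A j (Conn-trans p q)

    Conn-sym : ∀ {x y} → Conn G A x y → Conn G A y x
    Conn-sym here = here
    Conn-sym (step i i∈A j p) = Conn-trans (Conn-sym p) (step i i∈A (Joins-sym j) here)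

    Conn-invariant : ∀ {B : Set} (h : Fin (n G) → B) →
      (∀ {i x y} → i ∈ A → Joins G i x y → h x ≡ h y) → ∀ {x y} → Conn G A x y → h x ≡ h y
    Conn-invariant h h-edge here = refl
    Conn-invariant h h-edge (step i i∈A j p) = trans (h-edge i∈A j) (Conn-invariant h h-edge p)

    representative : ∀ {c} → HasComponents G A c → Fin c → Fin (n G)
    representative (_ , onto , _) k = proj₁ (onto k)

    label-representative-injective : ∀ {c} (hc : HasComponents G A c) {B : Set} (label : Fin (n G) → B) →
      (∀ {x y} → label x ≡ label y → Conn G A x y) → Injection (label ∘ representative hc)
    label-representative-injective (f , onto , f≡⇔Conn) label sound {k} {k′} e =
      trans (sym (proj₂ (onto k)))
        (trans (Equivalence.from (f≡⇔Conn _ _) (sound e)) (proj₂ (onto k′)))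

  edge-ends-on : ∀ {u v} (P : Path G u v) j {a b} → Joins G (edge P j) a b → OnPath a P × OnPath b P
  edge-ends-on P j a~b with Joins-unique a~b (joins P j)
  ... | inj₁ (refl , refl) = (inject₁ j , refl) , (suc j , refl)
  ... | inj₂ (refl , refl) = (suc j , refl) , (inject₁ j , refl)

  module _ {u v : Fin (n G)} (P : Path G u v) (A : Subset (m G)) where

    edge-Conn : ∀ j → edge P j ∈ A → Conn G A (vert P (inject₁ j)) (vert P (suc j))
    edge-Conn j j∈A = step (edge P j) j∈A (joins P j) here

    walk-to-start : ∀ i → Conn G A (vert P i) u ⊎
      ∃ λ j → toℕ j < toℕ i × edge P j ∉ A × Conn G A (vert P i) (vert P (suc j))
    walk-to-start i = go (toℕ i) i refl
      where
      go : ∀ k i → toℕ i ≡ k → Conn G A (vert P i) u ⊎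
        ∃ λ j → toℕ j < toℕ i × edge P j ∉ A × Conn G A (vert P i) (vert P (suc j))
      go zero zero _ = inj₁ (≡⇒Conn (start P))
      go (suc k) (suc j) eq with edge P j ∈? A
      ... | no j∉A = inj₂ (j , ≤-refl , j∉A , here)
      ... | yes j∈A with go k (inject₁ j) (trans (toℕ-inject₁ j) (suc-injective eq))
      ...   | inj₁ c = inj₁ (Conn-trans (Conn-sym (edge-Conn j j∈A)) c)
      ...   | inj₂ (j′ , j′<j , j′∉A , c) = inj₂ (j′ , m<n⇒m<1+n (subst (toℕ j′ <_) (toℕ-inject₁ j) j′<j) , j′∉A ,
                                                   Conn-trans (Conn-sym (edge-Conn j j∈A)) c)

    walk-to-end : ∀ i → Conn G A (vert P i) v ⊎
      ∃ λ j → toℕ i ≤ toℕ j × edge P j ∉ A × Conn G A (vert P i) (vert P (inject₁ j))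
    walk-to-end i = go (len P ∸ toℕ i) i (m+[n∸m]≡n (toℕ≤pred[n] i))
      where
      go : ∀ d i → toℕ i + d ≡ len P → Conn G A (vert P i) v ⊎
        ∃ λ j → toℕ i ≤ toℕ j × edge P j ∉ A × Conn G A (vert P i) (vert P (inject₁ j))
      go zero i eq = inj₁ (≡⇒Conn (trans (cong (vert P) i≡last) (stop P)))
        where i≡last = toℕ-injective (trans (trans (sym (+-identityʳ (toℕ i))) eq) (sym (toℕ-fromℕ (len P))))
      go (suc d) i eq with lower₁ i i≢last | inject₁-lower₁ i i≢last | toℕ-lower₁ i i≢last
        where i≢last = λ e → m+1+n≢m (toℕ i) {d} (trans eq e)
      ... | j | refl | tj with edge P j ∈? A
      ...   | no j∉A = inj₂ (j , ≤-reflexive (sym tj) , j∉A , here)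
      ...   | yes j∈A with go d (suc j) (trans (cong (λ t → suc t + d) tj) (trans (sym (+-suc (toℕ i) d)) eq))
      ...     | inj₁ c = inj₁ (Conn-trans (edge-Conn j j∈A) c)
      ...     | inj₂ (j′ , j<j′ , j′∉A , c) = inj₂ (j′ , ≤-trans (≤-reflexive (sym tj)) (<⇒≤ j<j′) , j′∉A ,
                                                      Conn-trans (edge-Conn j j∈A) c)

  len≤n : ∀ {u v} (P : Path G u v) → len P ≤ n G
  len≤n P = injective⇒≤ {f = vert P ∘ inject₁} λ {i} {j} e → case dist P _ _ e of λ where
      (inj₁ eq) → Finₚ.inject₁-injective eq
      (inj₂ (i-end , j-end)) → toℕ-injective (trans (at-start i i-end) (sym (at-start j j-end)))
    where
    at-start : ∀ i → EndPos (len P) (inject₁ i) → toℕ i ≡ 0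
    at-start i (inj₁ z) = trans (sym (toℕ-inject₁ i)) z
    at-start i (inj₂ l) = contradiction (trans (sym (toℕ-inject₁ i)) l) (<⇒≢ (toℕ<n i))

  connected⇒one-component : Connected G → Fin (n G) → HasComponents G ⊤ 1
  connected⇒one-component connected x =
    (λ _ → zero) , (λ { zero → x , refl }) , λ y z → mk⇔ (λ _ → connected y z) (λ _ → refl)

trivial-path : ∀ {G} (u : Fin (n G)) → Path G u u
trivial-path u = record { len = 0 ; vert = λ _ → u ; edge = λ () ; start = refl ; stop = refl
                        ; joins = λ () ; dist = λ { zero zero _ → inj₁ refl } }

record Theta (G : Graph) : Set where
  open GraphLemmas G using (len≤n)
  field
    u v : Fin (n G)
    X Y Z : Path G u v
    X∩Y : ShareOnlyEnds X Y
    X∩Z : ShareOnlyEnds X Z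
    Y∩Z : ShareOnlyEnds Y Z
    covers : ∀ w → OnPath w X ⊎ OnPath w Y ⊎ OnPath w Z
    edges-onto : ∀ e → ∃ λ k → EdgeOf3 X Y Z k ≡ e
    edges-injective : Injection (EdgeOf3 X Y Z)

  L₁ L₂ L₃ : ℕ
  L₁ = len X
  L₂ = len Y
  L₃ = len Z

  sum-of-lengths : L₁ + (L₂ + L₃) ≡ m G
  sum-of-lengths = bijective⇒≡₃ (EdgeOf3 X Y Z) edges-injective edges-onto

  -- Z alone has at most n edges
  0<L₁+L₂ : m G ≡ suc (n G) → 0 < L₁ + L₂
  0<L₁+L₂ m≡ = +-cancelʳ-≤ (n G) 1 (L₁ + L₂) (begin
    suc (n G)          ≡⟨ sym (trans sum-of-lengths m≡) ⟩
    L₁ + (L₂ + L₃)     ≡⟨ sym (+-assoc L₁ L₂ L₃) ⟩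
    L₁ + L₂ + L₃       ≤⟨ +-monoʳ-≤ (L₁ + L₂) (len≤n Z) ⟩
    L₁ + L₂ + n G      ∎)
    where open ≤-Reasoning

  0<L₂ : m G ≡ suc (n G) → L₁ ≤ L₂ → 0 < L₂
  0<L₂ m≡ X≤Y with L₂ | 0<L₁+L₂ m≡ | X≤Y
  ... | suc _ | _ | _ = s≤s z≤n
  ... | zero | 0<L₁+0 | L₁≤0 = contradiction (subst (0 <_) (trans (+-identityʳ L₁) (n≤0⇒n≡0 L₁≤0)) 0<L₁+0) λ ()

Balanced : ∀ {G} → Theta G → Set
Balanced t = L₁ ≤ L₂ × L₂ ≤ L₃ × L₃ ∸ L₂ ≤ L₁
  where open Theta t

Balanced⇒ThetaBalanced : ∀ {G} (t : Theta G) → Balanced t → ThetaBalanced G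
Balanced⇒ThetaBalanced t (X≤Y , Y≤Z , bal) =
  u , v , X , Y , Z , X∩Y , X∩Z , Y∩Z , covers , edges-onto , (λ k k′ → edges-injective) , X≤Y , Y≤Z , bal
  where open Theta t

ThetaBalanced⇒Balanced : ∀ {G} → ThetaBalanced G → Σ (Theta G) Balanced
ThetaBalanced⇒Balanced (u , v , X , Y , Z , X∩Y , X∩Z , Y∩Z , covers , onto , inj , X≤Y , Y≤Z , bal) =
  record { u = u ; v = v ; X = X ; Y = Y ; Z = Z ; X∩Y = X∩Y ; X∩Z = X∩Z ; Y∩Z = Y∩Z
         ; covers = covers ; edges-onto = onto ; edges-injective = inj _ _ } ,
  X≤Y , Y≤Z , bal

ShareOnlyEnds-sym : ∀ {G u v} {P Q : Path G u v} → ShareOnlyEnds P Q → ShareOnlyEnds Q P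
ShareOnlyEnds-sym P∩Q w w∈Q w∈P = P∩Q w w∈P w∈Q

module _ {M : ℕ} {K K′ : Set} {f : K → Fin M} {f′ : K′ → Fin M}
         (σ : K → K′) (σ⁻¹ : K′ → K) where

  reindex-onto : (∀ k → f′ (σ k) ≡ f k) → (∀ e → ∃ λ k → f k ≡ e) → ∀ e → ∃ λ k′ → f′ k′ ≡ e
  reindex-onto f′∘σ onto e = σ (proj₁ (onto e)) , trans (f′∘σ _) (proj₂ (onto e))

  reindex-injective : (∀ k′ → σ (σ⁻¹ k′) ≡ k′) → (∀ k′ → f (σ⁻¹ k′) ≡ f′ k′) → Injection f → Injection f′
  reindex-injective σσ⁻¹ f∘σ⁻¹ f-inj {k} {k′} e =
    trans (sym (σσ⁻¹ k)) (trans (cong σ (f-inj (trans (f∘σ⁻¹ k) (trans e (sym (f∘σ⁻¹ k′)))))) (σσ⁻¹ k′))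

swap₁₂ : ∀ {A B C : Set} → A ⊎ B ⊎ C → B ⊎ A ⊎ C
swap₁₂ (inj₁ j) = inj₂ (inj₁ j)
swap₁₂ (inj₂ (inj₁ j)) = inj₁ j
swap₁₂ (inj₂ (inj₂ j)) = inj₂ (inj₂ j)

swap₁₂-involutive : ∀ {A B C : Set} (k : A ⊎ B ⊎ C) → swap₁₂ (swap₁₂ k) ≡ k
swap₁₂-involutive (inj₁ _) = refl
swap₁₂-involutive (inj₂ (inj₁ _)) = refl
swap₁₂-involutive (inj₂ (inj₂ _)) = refl

swap₂₃ : ∀ {A B C : Set} → A ⊎ B ⊎ C → A ⊎ C ⊎ B
swap₂₃ (inj₁ j) = inj₁ j
swap₂₃ (inj₂ (inj₁ j)) = inj₂ (inj₂ j)
swap₂₃ (inj₂ (inj₂ j)) = inj₂ (inj₁ j)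

swap₂₃-involutive : ∀ {A B C : Set} (k : A ⊎ B ⊎ C) → swap₂₃ (swap₂₃ k) ≡ k
swap₂₃-involutive (inj₁ _) = refl
swap₂₃-involutive (inj₂ (inj₁ _)) = refl
swap₂₃-involutive (inj₂ (inj₂ _)) = refl

module _ {G : Graph} {u v : Fin (n G)} (P Q R : Path G u v) where

  EdgeOf3-swap₁₂ : ∀ k → EdgeOf3 Q P R (swap₁₂ k) ≡ EdgeOf3 P Q R k
  EdgeOf3-swap₁₂ (inj₁ _) = refl
  EdgeOf3-swap₁₂ (inj₂ (inj₁ _)) = refl
  EdgeOf3-swap₁₂ (inj₂ (inj₂ _)) = refl

  EdgeOf3-swap₂₃ : ∀ k → EdgeOf3 P R Q (swap₂₃ k) ≡ EdgeOf3 P Q R k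
  EdgeOf3-swap₂₃ (inj₁ _) = refl
  EdgeOf3-swap₂₃ (inj₂ (inj₁ _)) = refl
  EdgeOf3-swap₂₃ (inj₂ (inj₂ _)) = refl

module _ {G : Graph} where

  swapXY : Theta G → Theta G
  swapXY t = record
    { u = u ; v = v ; X = Y ; Y = X ; Z = Z
    ; X∩Y = ShareOnlyEnds-sym {P = X} {Q = Y} X∩Y ; X∩Z = Y∩Z ; Y∩Z = X∩Z
    ; covers = λ w → swap₁₂ (covers w)
    ; edges-onto = reindex-onto swap₁₂ swap₁₂ (EdgeOf3-swap₁₂ X Y Z) edges-onto
    ; edges-injective = reindex-injective swap₁₂ swap₁₂ swap₁₂-involutive (EdgeOf3-swap₁₂ Y X Z) edges-injective }
    where open Theta t

  swapYZ : Theta G → Theta G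
  swapYZ t = record
    { u = u ; v = v ; X = X ; Y = Z ; Z = Y
    ; X∩Y = X∩Z ; X∩Z = X∩Y ; Y∩Z = ShareOnlyEnds-sym {P = Y} {Q = Z} Y∩Z
    ; covers = λ w → swap₂₃ (covers w)
    ; edges-onto = reindex-onto swap₂₃ swap₂₃ (EdgeOf3-swap₂₃ X Y Z) edges-onto
    ; edges-injective = reindex-injective swap₂₃ swap₂₃ swap₂₃-involutive (EdgeOf3-swap₂₃ X Z Y) edges-injective }
    where open Theta t

module _ {G : Graph} {u v : Fin (n G)} (X Y Z : Path G u v) where
  open GraphLemmas G

  OnSome : Fin (n G) → Set
  OnSome w = OnPath w X ⊎ OnPath w Y ⊎ OnPath w Z

  EdgeOf3-ends-on : ∀ k {a b} → Joins G (EdgeOf3 X Y Z k) a b → OnSome b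
  EdgeOf3-ends-on (inj₁ j) a~b = inj₁ (proj₂ (edge-ends-on X j a~b))
  EdgeOf3-ends-on (inj₂ (inj₁ j)) a~b = inj₂ (inj₁ (proj₂ (edge-ends-on Y j a~b)))
  EdgeOf3-ends-on (inj₂ (inj₂ j)) a~b = inj₂ (inj₂ (proj₂ (edge-ends-on Z j a~b)))

  Closed : Set
  Closed = ∀ w → OnSome w → ∀ e → Incident G e w → ∃ λ k → EdgeOf3 X Y Z k ≡ e

  module _ (connected : Connected G) (closed : Closed) where

    closed⇒covers : ∀ w → OnSome w
    closed⇒covers w = go (inj₁ (zero , start X)) (connected u w)
      where
      go : ∀ {a} → OnSome a → Conn G ⊤ a w → OnSome w
      go a-on here = a-on
      go a-on (step i _ a~b rest) with closed _ a-on i (Joins⇒Incidentˡ a~b)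
      ... | k , refl = go (EdgeOf3-ends-on k a~b) rest

    closed⇒onto : ∀ e → ∃ λ k → EdgeOf3 X Y Z k ≡ e
    closed⇒onto e = closed _ (closed⇒covers _) e (inj₁ refl)

cancel-gaps : ∀ c a s M → c + (a + s) ≤ s + M → c + a ≤ M
cancel-gaps c a s M le = +-cancelˡ-≤ s (c + a) M (≤-trans (≤-reflexive (reorder c a s)) le)
  where
  reorder : ∀ c a s → s + (c + a) ≡ c + (a + s)
  reorder = solve-∀

-- The density inequality |A| * rank E ≤ |E| * rank A, where |E| = n + 1 and c = c(A),
-- from bounds on c + |A| (the number of components plus the edges kept).

two-gaps-dense : ∀ a c cE n → c + (a + 2) ≤ suc (suc n) → a * (n ∸ cE) ≤ suc n * (n ∸ c)
two-gaps-dense a c cE n le = begin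
  a * (n ∸ cE)     ≤⟨ *-mono-≤ a≤n∸c (≤-trans (m∸n≤m n cE) (n≤1+n n)) ⟩
  (n ∸ c) * suc n  ≡⟨ *-comm (n ∸ c) (suc n) ⟩
  suc n * (n ∸ c)  ∎
  where
  open ≤-Reasoning
  a≤n∸c : a ≤ n ∸ c
  a≤n∸c = m+n≤o⇒m≤o∸n a (≤-trans (≤-reflexive (+-comm a c)) (cancel-gaps c a 2 n le))

private
  half≤ : ∀ c n → c + c ≤ suc n → c ≤ n
  half≤ zero n _ = z≤n
  half≤ (suc c) n (s≤s le) = m+n≤o⇒n≤o c le

  slope : ∀ c t → c ≤ suc t → suc t * (c + t ∸ 1) ≤ suc (c + t) * t
  slope c t c≤1+t with c + t in c+t≡
  ... | zero = ≤-trans (≤-reflexive (*-zeroʳ (suc t))) z≤n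
  ... | suc k = begin
    suc t * k          ≡⟨⟩
    k + t * k          ≤⟨ +-mono-≤ k≤2t (≤-reflexive (*-comm t k)) ⟩
    t + t + k * t      ≡⟨ expand k t ⟩
    suc (suc k) * t    ∎
    where
    open ≤-Reasoning
    k≤2t : k ≤ t + t
    k≤2t = ≤-pred (≤-trans (≤-reflexive (sym c+t≡)) (+-monoˡ-≤ t c≤1+t))
    expand : ∀ k t → t + t + k * t ≡ suc (suc k) * t
    expand = solve-∀

one-gap-dense : ∀ a c cE n → c + (a + 1) ≤ suc (suc n) → c + c ≤ suc n → 1 ≤ cE →
                a * (n ∸ cE) ≤ suc n * (n ∸ c)
one-gap-dense a c cE n le c+c≤ 1≤cE = begin
  a * (n ∸ cE)          ≤⟨ *-mono-≤ a≤1+t (∸-monoʳ-≤ n 1≤cE) ⟩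
  suc t * (n ∸ 1)       ≡⟨ cong (λ k → suc t * (k ∸ 1)) (sym c+t≡n) ⟩
  suc t * (c + t ∸ 1)   ≤⟨ slope c t c≤1+t ⟩
  suc (c + t) * t       ≡⟨ cong (λ k → suc k * t) c+t≡n ⟩
  suc n * t             ∎
  where
  open ≤-Reasoning
  t = n ∸ c
  c+t≡n : c + t ≡ n
  c+t≡n = m+[n∸m]≡n (half≤ c n c+c≤)
  n+1≡c+1+t : suc n ≡ c + suc t
  n+1≡c+1+t = trans (cong suc (sym c+t≡n)) (sym (+-suc c t))
  a≤1+t : a ≤ suc t
  a≤1+t = +-cancelˡ-≤ c a (suc t) (≤-trans (cancel-gaps c a 1 (suc n) le) (≤-reflexive n+1≡c+1+t))
  c≤1+t : c ≤ suc t
  c≤1+t = +-cancelˡ-≤ c c (suc t) (≤-trans c+c≤ (≤-reflexive n+1≡c+1+t))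

one-gap-few-components : ∀ c a l r M → c + (a + 1) ≤ suc M → r ≤ a → l + r ≡ M → l ≤ r → c + c ≤ M
one-gap-few-components c a l r M le r≤a l+r≡M l≤r = begin
  c + c  ≤⟨ +-mono-≤ c≤l c≤l ⟩
  l + l  ≤⟨ +-monoʳ-≤ l l≤r ⟩
  l + r  ≡⟨ l+r≡M ⟩
  M      ∎
  where
  open ≤-Reasoning
  c≤l : c ≤ l
  c≤l = +-cancelʳ-≤ r c l (≤-trans (+-monoʳ-≤ c r≤a) (≤-trans (cancel-gaps c a 1 M le) (≤-reflexive (sym l+r≡M))))

-- Given cut edges j₁ on X and j₂ on Y, every vertex is labelled either by nothing
-- (it is A-connected to u) or by an edge missing from A, other than the cuts,
-- next to which it is A-connected to a fixed vertex (its anchor).  Vertices with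
-- the same label are A-connected, so there are at most 1 + |∁A| - (cuts ∉ A) components.
module Labelling {G : Graph} (t : Theta G) (A : Subset (m G)) (j₁ : Fin (Theta.L₁ t)) (j₂ : Fin (Theta.L₂ t)) where
  open Theta t
  open GraphLemmas G

  Position : Set
  Position = Fin L₁ ⊎ Fin L₂ ⊎ Fin L₃

  E3 : Position → Fin (m G)
  E3 = EdgeOf3 X Y Z

  cut₁ cut₂ : Position
  cut₁ = inj₁ j₁
  cut₂ = inj₂ (inj₁ j₂)

  -- the end of edge j of P on the same side of the cut as the walk that stops at j
  nearEnd : (P : Path G u v) → Fin (len P) → Fin (len P) → Fin (n G)
  nearEnd P cut j with toℕ j <? toℕ cut
  ... | yes _ = vert P (suc j)
  ... | no _ = vert P (inject₁ j)

  nearEnd-< : ∀ (P : Path G u v) cut j → toℕ j < toℕ cut → nearEnd P cut j ≡ vert P (suc j)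
  nearEnd-< P cut j j<cut with toℕ j <? toℕ cut
  ... | yes _ = refl
  ... | no j≮cut = contradiction j<cut j≮cut

  nearEnd-≮ : ∀ (P : Path G u v) cut j → ¬ toℕ j < toℕ cut → nearEnd P cut j ≡ vert P (inject₁ j)
  nearEnd-≮ P cut j j≮cut with toℕ j <? toℕ cut
  ... | yes j<cut = contradiction j<cut j≮cut
  ... | no _ = refl

  anchor : Position → Fin (n G)
  anchor (inj₁ j) = nearEnd X j₁ j
  anchor (inj₂ (inj₁ j)) = nearEnd Y j₂ j
  anchor (inj₂ (inj₂ j)) = vert Z (suc j)

  Witness : Fin (n G) → Maybe Position → Set
  Witness x nothing = Conn G A x u
  Witness x (just p) = E3 p ∉ A × p ≢ cut₁ × p ≢ cut₂ × Conn G A x (anchor p)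

  Labelled : Fin (n G) → Set
  Labelled x = Σ (Maybe Position) (Witness x)

  Witness-Conn : ∀ {x y} r → Conn G A x y → Witness y r → Witness x r
  Witness-Conn nothing x~y w = Conn-trans x~y w
  Witness-Conn (just p) x~y (p∉A , p≢cut₁ , p≢cut₂ , w) = p∉A , p≢cut₁ , p≢cut₂ , Conn-trans x~y w

  label-on-Z : ∀ i → Labelled (vert Z i)
  label-on-Z i with walk-to-start Z A i
  ... | inj₁ c = nothing , c
  ... | inj₂ (j , _ , j∉A , c) = just (inj₂ (inj₂ j)) , j∉A , (λ ()) , (λ ()) , c

  label-v : Labelled v
  label-v with label-on-Z (fromℕ (len Z))
  ... | r , w = r , Witness-Conn r (≡⇒Conn (sym (stop Z))) w

  module OnCutPath (P : Path G u v) (cut : Fin (len P)) (pos : Fin (len P) → Position)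
       (pos-edge : ∀ j → E3 (pos j) ≡ edge P j)
       (pos-anchor : ∀ j → anchor (pos j) ≡ nearEnd P cut j)
       (pos-cut : ∀ j → toℕ j ≢ toℕ cut → pos j ≢ cut₁ × pos j ≢ cut₂) where

    labelAt : ∀ j → toℕ j ≢ toℕ cut → edge P j ∉ A → ∀ {x} → Conn G A x (nearEnd P cut j) → Labelled x
    labelAt j j≢cut j∉A c =
      just (pos j) , subst (_∉ A) (sym (pos-edge j)) j∉A , proj₁ (pos-cut j j≢cut) , proj₂ (pos-cut j j≢cut) ,
      subst (Conn G A _) (sym (pos-anchor j)) c

    label-on : ∀ i → Labelled (vert P i)
    label-on i with toℕ i ≤? toℕ cut
    ... | yes i≤cut with walk-to-start P A i
    ...   | inj₁ c = nothing , c
    ...   | inj₂ (j , j<i , j∉A , c) = labelAt j (<⇒≢ j<cut) j∉A (subst (Conn G A _) (sym (nearEnd-< P cut j j<cut)) c)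
      where j<cut = <-≤-trans j<i i≤cut
    label-on i | no i≰cut with walk-to-end P A i
    ...   | inj₁ c = proj₁ label-v , Witness-Conn (proj₁ label-v) c (proj₂ label-v)
    ...   | inj₂ (j , i≤j , j∉A , c) = labelAt j (λ e → i≰cut (≤-trans i≤j (≤-reflexive e))) j∉A
                                        (subst (Conn G A _) (sym (nearEnd-≮ P cut j (λ j<cut → i≰cut (≤-trans i≤j (<⇒≤ j<cut))))) c)

  module OnX = OnCutPath X j₁ inj₁ (λ _ → refl) (λ _ → refl)
                 (λ j j≢j₁ → (λ e → j≢j₁ (cong toℕ (inj₁-injective e))) , (λ ()))
  module OnY = OnCutPath Y j₂ (inj₂ ∘ inj₁) (λ _ → refl) (λ _ → refl)
                 (λ j j≢j₂ → (λ ()) , (λ e → j≢j₂ (cong toℕ (inj₁-injective (inj₂-injective e)))))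

  label : ∀ x → Labelled x
  label x with covers x
  ... | inj₁ (i , refl) = OnX.label-on i
  ... | inj₂ (inj₁ (i , refl)) = OnY.label-on i
  ... | inj₂ (inj₂ (i , refl)) = label-on-Z i

  same-label⇒Conn : ∀ {x y} → proj₁ (label x) ≡ proj₁ (label y) → Conn G A x y
  same-label⇒Conn {x} {y} e = go (label x) (label y) e
    where
    go : (a : Labelled x) (b : Labelled y) → proj₁ a ≡ proj₁ b → Conn G A x y
    go (nothing , cx) (.nothing , cy) refl = Conn-trans cx (Conn-sym cy)
    go (just p , (_ , _ , _ , cx)) (.(just p) , (_ , _ , _ , cy)) refl = Conn-trans cx (Conn-sym cy)

  module _ {c} (hc : HasComponents G A c) where

    componentLabel : Fin c → Maybe (Fin (m G))
    componentLabel k = Maybe.map E3 (proj₁ (label (representative hc k)))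

    componentLabel-injective : Injection componentLabel
    componentLabel-injective =
      label-representative-injective hc (λ x → Maybe.map E3 (proj₁ (label x)))
        (same-label⇒Conn ∘ map-injective edges-injective)

    componentLabel-avoids : ∀ k {e} → componentLabel k ≡ just e → e ∉ A × e ≢ E3 cut₁ × e ≢ E3 cut₂
    componentLabel-avoids k = go (label (representative hc k))
      where
      go : ∀ {x} (r : Labelled x) {e} → Maybe.map E3 (proj₁ r) ≡ just e → e ∉ A × e ≢ E3 cut₁ × e ≢ E3 cut₂
      go (just p , p∉A , p≢cut₁ , p≢cut₂ , _) refl =
        p∉A , (λ e → p≢cut₁ (edges-injective e)) , (λ e → p≢cut₂ (edges-injective e))

    components+∣A∣+gaps≤ : ∀ {s} (gap : Fin s → Position) → Injection gap →
      (∀ i → gap i ≡ cut₁ ⊎ gap i ≡ cut₂) → (∀ i → E3 (gap i) ∉ A) → c + (∣ A ∣ + s) ≤ suc (m G)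
    components+∣A∣+gaps≤ gap gap-inj gap-cut gap∉A =
      labels+∣A∣+extras≤ A componentLabel (E3 ∘ gap) componentLabel-injective (gap-inj ∘ edges-injective)
        (λ k → proj₁ ∘ componentLabel-avoids k) gap∉A label≢gap
      where
      label≢gap : ∀ k i → componentLabel k ≢ just (E3 (gap i))
      label≢gap k i e with gap-cut i | componentLabel-avoids k e
      ... | inj₁ gap≡cut₁ | _ , ≢cut₁ , _ = ≢cut₁ (cong E3 gap≡cut₁)
      ... | inj₂ gap≡cut₂ | _ , _ , ≢cut₂ = ≢cut₂ (cong E3 gap≡cut₂)

Dense : (G : Graph) → Subset (m G) → ℕ → ℕ → Set
Dense G A c cE = ∣ A ∣ * rankWith G cE ≤ m G * rankWith G c

Full : ∀ {G u v} → Path G u v → Subset (m G) → Set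
Full P A = ∀ j → edge P j ∈ A

Gap : ∀ {G u v} → Path G u v → Subset (m G) → Set
Gap P A = ∃ λ j → edge P j ∉ A

full-or-gap : ∀ {G u v} (P : Path G u v) (A : Subset (m G)) → Full P A ⊎ Gap P A
full-or-gap P A with all? (λ j → edge P j ∈? A)
... | yes full = inj₁ full
... | no ¬full = inj₂ (¬∀⟶∃¬ _ _ (λ j → edge P j ∈? A) ¬full)

module _ {G : Graph} (m≡ : m G ≡ suc (n G)) (A : Subset (m G)) {c cE : ℕ} (hA : HasComponents G A c) where

  dense-if : ∣ A ∣ * (n G ∸ cE) ≤ suc (n G) * (n G ∸ c) → Dense G A c cE
  dense-if = subst (λ M → ∣ A ∣ * (n G ∸ cE) ≤ M * (n G ∸ c)) (sym m≡)

  two-gaps⇒dense : (t : Theta G) (j₁ : Fin (Theta.L₁ t)) (j₂ : Fin (Theta.L₂ t)) →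
    edge (Theta.X t) j₁ ∉ A → edge (Theta.Y t) j₂ ∉ A → Dense G A c cE
  two-gaps⇒dense t j₁ j₂ j₁∉A j₂∉A = dense-if (two-gaps-dense ∣ A ∣ c cE (n G) (subst (λ M → c + (∣ A ∣ + 2) ≤ suc M) m≡ count))
    where
    open Labelling t A j₁ j₂
    gap : Fin 2 → Position
    gap zero = cut₁
    gap (suc zero) = cut₂
    gap-injective : Injection gap
    gap-injective {zero} {zero} _ = refl
    gap-injective {zero} {suc zero} ()
    gap-injective {suc zero} {zero} ()
    gap-injective {suc zero} {suc zero} _ = refl
    count = components+∣A∣+gaps≤ hA gap gap-injective
              (λ { zero → inj₁ refl ; (suc zero) → inj₂ refl }) (λ { zero → j₁∉A ; (suc zero) → j₂∉A })

  one-gap⇒dense : 1 ≤ cE → (t : Theta G) → Theta.L₁ t ≤ Theta.L₂ t + Theta.L₃ t →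
    (j₁ : Fin (Theta.L₁ t)) → edge (Theta.X t) j₁ ∉ A → Fin (Theta.L₂ t) →
    Full (Theta.Y t) A → Full (Theta.Z t) A → Dense G A c cE
  one-gap⇒dense 1≤cE t X≤Y+Z j₁ j₁∉A j₂ Y-full Z-full =
    dense-if (one-gap-dense ∣ A ∣ c cE (n G) (subst (λ M → c + (∣ A ∣ + 1) ≤ suc M) m≡ count)
               (subst (c + c ≤_) m≡ few-components) 1≤cE)
    where
    open Theta t
    open Labelling t A j₁ j₂
    count = components+∣A∣+gaps≤ hA (λ _ → cut₁) (λ { {zero} {zero} _ → refl }) (λ _ → inj₁ refl) (λ _ → j₁∉A)
    Y+Z≤∣A∣ : L₂ + L₃ ≤ ∣ A ∣
    Y+Z≤∣A∣ = injective⊎⇒≤∣∣ A (E3 ∘ inj₂) (inj₂-injective ∘ edges-injective)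
                λ { (inj₁ j) → Y-full j ; (inj₂ j) → Z-full j }
    few-components = one-gap-few-components c ∣ A ∣ L₁ (L₂ + L₃) (m G) count Y+Z≤∣A∣ sum-of-lengths X≤Y+Z

  no-gap⇒dense : (∀ e → e ∈ A) → HasComponents G ⊤ cE → Dense G A c cE
  no-gap⇒dense all∈A hE = *-mono-≤ (∣p∣≤n A) (∸-monoʳ-≤ (n G) c≤cE)
    where
    open GraphLemmas G
    Conn⊤⇒ConnA : ∀ {x y} → Conn G ⊤ x y → Conn G A x y
    Conn⊤⇒ConnA here = here
    Conn⊤⇒ConnA (step i _ j p) = step i (all∈A i) j (Conn⊤⇒ConnA p)
    c≤cE : c ≤ cE
    c≤cE = injective⇒≤ (label-representative-injective hA (proj₁ hE)
             (Conn⊤⇒ConnA ∘ Equivalence.to (proj₂ (proj₂ hE) _ _)))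

module _ {G : Graph} (m≡ : m G ≡ suc (n G)) (t : Theta G) (bal : Balanced t) where
  open Theta t

  private
    X≤Y = proj₁ bal
    Y≤Z = proj₁ (proj₂ bal)
    Z∸Y≤X = proj₂ (proj₂ bal)

  Balanced⇒UniformlyDense : UniformlyDense G
  Balanced⇒UniformlyDense A _ c cE hA hE = by-gaps (full-or-gap X A) (full-or-gap Y A) (full-or-gap Z A)
    where
    two-gaps = two-gaps⇒dense m≡ A {cE = cE} hA
    one-gap = one-gap⇒dense m≡ A hA (≤-trans (s≤s z≤n) (toℕ<n (proj₁ hE u)))
    by-gaps : Full X A ⊎ Gap X A → Full Y A ⊎ Gap Y A → Full Z A ⊎ Gap Z A → Dense G A c cE
    by-gaps (inj₂ (j₁ , g₁)) (inj₂ (j₂ , g₂)) _ = two-gaps t j₁ j₂ g₁ g₂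
    by-gaps (inj₂ (j₁ , g₁)) (inj₁ _) (inj₂ (j₃ , g₃)) = two-gaps (swapYZ t) j₁ j₃ g₁ g₃
    by-gaps (inj₁ _) (inj₂ (j₂ , g₂)) (inj₂ (j₃ , g₃)) = two-gaps (swapYZ (swapXY t)) j₂ j₃ g₂ g₃
    by-gaps (inj₂ (j₁ , g₁)) (inj₁ fY) (inj₁ fZ) =
      one-gap t (≤-trans X≤Y (m≤m+n L₂ L₃)) j₁ g₁ (fromℕ< (0<L₂ m≡ X≤Y)) fY fZ
    by-gaps (inj₁ fX) (inj₂ (j₂ , g₂)) (inj₁ fZ) =
      one-gap (swapYZ (swapXY t)) (≤-trans Y≤Z (m≤m+n L₃ L₁)) j₂ g₂ (fromℕ< (<-≤-trans (0<L₂ m≡ X≤Y) Y≤Z)) fZ fX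
    by-gaps (inj₁ fX) (inj₁ fY) (inj₂ (j₃ , g₃)) =
      one-gap (swapYZ (swapXY (swapYZ t))) (≤-trans (m≤n+m∸n L₃ L₂) (+-monoʳ-≤ L₂ Z∸Y≤X)) j₃ g₃
        (fromℕ< (0<L₂ m≡ X≤Y)) fY fX
    by-gaps (inj₁ fX) (inj₁ fY) (inj₁ fZ) = no-gap⇒dense m≡ A hA every-edge∈A hE
      where
      every-edge∈A : ∀ e → e ∈ A
      every-edge∈A e with edges-onto e
      ... | inj₁ j , refl = fX j
      ... | inj₂ (inj₁ j) , refl = fY j
      ... | inj₂ (inj₂ j) , refl = fZ j

𝟙 : Bool → ℕ
𝟙 true = 1
𝟙 false = 0

sum-const : ∀ k c → sum {k} (λ _ → c) ≡ k * c
sum-const zero c = refl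
sum-const (suc k) c = cong (c +_) (sum-const k c)

∣tabulate∣≡sum : ∀ {k} (h : Fin k → Bool) → ∣ tabulate h ∣ ≡ sum (𝟙 ∘ h)
∣tabulate∣≡sum {zero} h = refl
∣tabulate∣≡sum {suc k} h with h zero
... | true = cong suc (∣tabulate∣≡sum (h ∘ suc))
... | false = ∣tabulate∣≡sum (h ∘ suc)

sum-𝟙-≟ : ∀ {k} (a : Fin k) → sum (λ x → 𝟙 (does (a F.≟ x))) ≡ 1
sum-𝟙-≟ {suc k} zero = cong suc (sum-replicate-zero k)
sum-𝟙-≟ {suc k} (suc a) = trans (sum-cong-≗ same) (sum-𝟙-≟ a)
  where
  same : ∀ x → 𝟙 (does (suc a F.≟ suc x)) ≡ 𝟙 (does (a F.≟ x))
  same x with a F.≟ x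
  ... | yes _ = refl
  ... | no _ = refl

𝟙-∨ : ∀ a b → (a ≡ true → b ≡ true → ⊥) → 𝟙 (a ∨ b) ≡ 𝟙 a + 𝟙 b
𝟙-∨ true true both = ⊥-elim (both refl refl)
𝟙-∨ true false _ = refl
𝟙-∨ false b _ = refl

sum≡0⇒ : ∀ {k} (g : Fin k → ℕ) → sum g ≡ 0 → ∀ x → g x ≡ 0
sum≡0⇒ g e zero = m+n≡0⇒m≡0 (g zero) e
sum≡0⇒ g e (suc x) = sum≡0⇒ (g ∘ suc) (m+n≡0⇒n≡0 (g zero) e) x

sum≡1⇒ : ∀ {k} (g : Fin k → ℕ) → sum g ≡ 1 → ∃ λ u → g u ≡ 1 × (∀ x → x ≢ u → g x ≡ 0)
sum≡1⇒ {suc k} g e with g zero in g₀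
... | zero with u , gu , rest ← sum≡1⇒ (g ∘ suc) e =
  suc u , gu , λ { zero _ → g₀ ; (suc x) x≢u → rest x (x≢u ∘ cong suc) }
... | suc zero = zero , g₀ , λ { zero 0≢0 → contradiction refl 0≢0 ; (suc x) _ → sum≡0⇒ (g ∘ suc) (suc-injective e) x }

SplitsTwo : ∀ {k} → (Fin k → ℕ) → Set
SplitsTwo g =
  (∃ λ u → g u ≡ 2 × (∀ x → x ≢ u → g x ≡ 0)) ⊎
  (∃ λ u → ∃ λ v → u ≢ v × g u ≡ 1 × g v ≡ 1 × (∀ x → x ≢ u → x ≢ v → g x ≡ 0))

sum≡2⇒ : ∀ {k} (g : Fin k → ℕ) → sum g ≡ 2 → SplitsTwo g
sum≡2⇒ {suc k} g e with g zero in g₀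
... | zero with sum≡2⇒ (g ∘ suc) e
...   | inj₁ (u , gu , rest) = inj₁ (suc u , gu , λ { zero _ → g₀ ; (suc x) x≢u → rest x (x≢u ∘ cong suc) })
...   | inj₂ (u , v , u≢v , gu , gv , rest) = inj₂ (suc u , suc v , u≢v ∘ Finₚ.suc-injective , gu , gv ,
          λ { zero _ _ → g₀ ; (suc x) x≢u x≢v → rest x (x≢u ∘ cong suc) (x≢v ∘ cong suc) })
sum≡2⇒ {suc k} g e | suc zero with v , gv , rest ← sum≡1⇒ (g ∘ suc) (suc-injective e) =
  inj₂ (zero , suc v , (λ ()) , g₀ , gv ,
        λ { zero 0≢0 _ → contradiction refl 0≢0 ; (suc x) _ x≢v → rest x (x≢v ∘ cong suc) })
sum≡2⇒ {suc k} g e | suc (suc zero) =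
  inj₁ (zero , g₀ , λ { zero 0≢0 → contradiction refl 0≢0 ; (suc x) _ → sum≡0⇒ (g ∘ suc) (suc-injective (suc-injective e)) x })

module Degrees (G : Graph) (loopless : ∀ i → proj₁ (ends G i) ≢ proj₂ (ends G i)) where

  incident? : ∀ e x → Dec (Incident G e x)
  incident? e x = (proj₁ (ends G e) F.≟ x) ⊎-dec (proj₂ (ends G e) F.≟ x)

  incidences : Fin (n G) → Subset (m G)
  incidences x = tabulate (λ e → does (incident? e x))

  deg : Fin (n G) → ℕ
  deg x = ∣ incidences x ∣

  ∈incidences⇔ : ∀ {e x} → e ∈ incidences x ⇔ Incident G e x
  ∈incidences⇔ {e} {x} = mk⇔
    (λ e∈ → toIncident (incident? e x) (trans (sym (lookup∘tabulate _ e)) ([]=⇒lookup e∈)))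
    (λ inc → lookup⇒[]= e _ (trans (lookup∘tabulate _ e) (dec-true (incident? e x) inc)))
    where
    toIncident : (d : Dec (Incident G e x)) → does d ≡ true → Incident G e x
    toIncident (yes p) _ = p

  dart : ∀ x → Fin (deg x) → Fin (m G)
  dart x = nth (incidences x)

  dart-incident : ∀ x k → Incident G (dart x k) x
  dart-incident x k = Equivalence.to ∈incidences⇔ (nth-∈ (incidences x) k)

  dart-injective : ∀ x → Injection (dart x)
  dart-injective x = nth-injective (incidences x)

  dart-onto : ∀ {x e} → Incident G e x → ∃ λ k → dart x k ≡ e
  dart-onto {x} inc = nth-surjective (incidences x) (Equivalence.from ∈incidences⇔ inc)

  handshake : sum deg ≡ m G * 2
  handshake = begin
    sum deg                                                        ≡⟨ sum-cong-≗ (λ x → ∣tabulate∣≡sum (λ e → does (incident? e x))) ⟩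
    sum (λ x → sum (λ e → 𝟙 (does (incident? e x))))               ≡⟨ ∑-comm (λ x e → 𝟙 (does (incident? e x))) ⟩
    sum (λ e → sum (λ x → 𝟙 (does (incident? e x))))               ≡⟨ sum-cong-≗ (λ e → sum-cong-≗ (λ x → 𝟙-∨ (does (end₁ e F.≟ x)) _ (not-both e x))) ⟩
    sum (λ e → sum (λ x → 𝟙 (does (end₁ e F.≟ x)) + 𝟙 (does (end₂ e F.≟ x))))
                                                                   ≡⟨ sum-cong-≗ (λ e → ∑-distrib-+ (λ x → 𝟙 (does (end₁ e F.≟ x))) (λ x → 𝟙 (does (end₂ e F.≟ x)))) ⟩
    sum (λ e → sum (λ x → 𝟙 (does (end₁ e F.≟ x))) + sum (λ x → 𝟙 (does (end₂ e F.≟ x))))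
                                                                   ≡⟨ sum-cong-≗ (λ e → cong₂ _+_ (sum-𝟙-≟ (end₁ e)) (sum-𝟙-≟ (end₂ e))) ⟩
    sum {m G} (λ _ → 2)                                            ≡⟨ sum-const (m G) 2 ⟩
    m G * 2                                                        ∎
    where
    open ≡-Reasoning
    end₁ end₂ : Fin (m G) → Fin (n G)
    end₁ e = proj₁ (ends G e)
    end₂ e = proj₂ (ends G e)
    not-both : ∀ e x → does (end₁ e F.≟ x) ≡ true → does (end₂ e F.≟ x) ≡ true → ⊥
    not-both e x _ _ with end₁ e F.≟ x | end₂ e F.≟ x
    ... | yes p | yes q = loopless e (trans p (sym q))

  module DartsOf (x : Fin (n G)) {k} (deg≡ : deg x ≡ k) where

    darts : Fin k → Fin (m G)
    darts i = dart x (subst Fin (sym deg≡) i)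

    darts-incident : ∀ i → Incident G (darts i) x
    darts-incident i = dart-incident x _

    darts-injective : Injection darts
    darts-injective {i} {j} e =
      trans (sym (subst-subst-sym deg≡)) (trans (cong (subst Fin deg≡) (dart-injective x e)) (subst-subst-sym deg≡))

    darts-onto : ∀ {e} → Incident G e x → ∃ λ i → darts i ≡ e
    darts-onto inc with j , refl ← dart-onto inc = subst Fin deg≡ j , cong (dart x) (subst-sym-subst deg≡)

distinct⇒2≤ : ∀ {k} {s w : Fin k} → s ≢ w → 2 ≤ k
distinct⇒2≤ {s = s} {w} s≢w = injective⇒≤ {f = pair} pair-injective
  where
  pair : Fin 2 → Fin _
  pair zero = s
  pair (suc zero) = w
  pair-injective : Injection pair
  pair-injective {zero} {zero} _ = refl
  pair-injective {zero} {suc zero} e = contradiction e s≢w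
  pair-injective {suc zero} {zero} e = contradiction (sym e) s≢w
  pair-injective {suc zero} {suc zero} _ = refl

bridge-dense-arith : ∀ k → ¬ (suc (suc k) * (suc (suc k) ∸ 1) ≤ suc (suc (suc k)) * (suc (suc k) ∸ 2))
bridge-dense-arith k le = 1+n≰n (≤-trans (≤-reflexive (sym (expand k))) (≤-trans le (n≤1+n _)))
  where
  expand : ∀ k → suc (suc k) * suc k ≡ suc (suc (suc (suc (suc k)) * k))
  expand = solve-∀

-- If d is the only edge leaving S, then E - d has two components and density
-- n / (n - 2), more than (n + 1) / (n - 1).
module NoBridge (G : Graph) (connected : Connected G) {S : Fin (n G) → Set} (S? : ∀ x → Dec (S x))
                {d : Fin (m G)} {s w : Fin (n G)} (d-joins : Joins G d s w) (s∈S : S s) (w∉S : ¬ S w)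
                (stays : ∀ {i x y} → i ≢ d → Joins G i x y → S x → S y) where
  open GraphLemmas G

  A : Subset (m G)
  A = ∁ ⁅ d ⁆

  ∈A⇒≢d : ∀ {i} → i ∈ A → i ≢ d
  ∈A⇒≢d i∈A refl = x∈p⇒x∉∁p (x∈⁅x⁆ d) i∈A

  ≢d⇒∈A : ∀ {i} → i ≢ d → i ∈ A
  ≢d⇒∈A i≢d = x∉p⇒x∈∁p (i≢d ∘ x∈⁅y⁆⇒x≡y d)

  ∣A∣≡ : ∣ A ∣ ≡ m G ∸ 1
  ∣A∣≡ = trans (∣∁p∣≡n∸∣p∣ ⁅ d ⁆) (cong (m G ∸_) (∣⁅x⁆∣≡1 d))

  side : Fin (n G) → Fin 2
  side x with S? x
  ... | yes _ = zero
  ... | no _ = suc zero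

  endOn : Fin 2 → Fin (n G)
  endOn zero = s
  endOn (suc zero) = w

  end : Fin (n G) → Fin (n G)
  end = endOn ∘ side

  side-edge : ∀ {i x y} → i ∈ A → Joins G i x y → side x ≡ side y
  side-edge {x = x} {y} i∈A x~y with S? x | S? y
  ... | yes _ | yes _ = refl
  ... | yes x∈S | no y∉S = contradiction (stays (∈A⇒≢d i∈A) x~y x∈S) y∉S
  ... | no x∉S | yes y∈S = contradiction (stays (∈A⇒≢d i∈A) (Joins-sym x~y) y∈S) x∉S
  ... | no _ | no _ = refl

  Conn-end : ∀ x → Conn G A x (end x)
  Conn-end x = along (connected s x) s-at-end
    where
    s-at-end : Conn G A s (end s)
    s-at-end with S? s
    ... | yes _ = here
    ... | no s∉S = contradiction s∈S s∉S
    along : ∀ {a} → Conn G ⊤ a x → Conn G A a (end a) → Conn G A x (end x)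
    along here a~end = a~end
    along {a} (step i _ a~b rest) a~end with i F.≟ d
    ... | no i≢d = along rest (Conn-trans (Conn-sym (step i (≢d⇒∈A i≢d) a~b here))
                                (subst (Conn G A a) (cong endOn (side-edge (≢d⇒∈A i≢d) a~b)) a~end))
    ... | yes refl = along rest (≡⇒Conn (d-end (Joins-unique a~b d-joins)))
      where
      d-end : ∀ {b} → (a ≡ s × b ≡ w) ⊎ (a ≡ w × b ≡ s) → b ≡ end b
      d-end {b} ends with S? b
      d-end (inj₁ (_ , refl)) | yes w∈S = contradiction w∈S w∉S
      d-end (inj₂ (_ , b≡s)) | yes _ = b≡s
      d-end (inj₁ (_ , b≡w)) | no _ = b≡w
      d-end (inj₂ (_ , refl)) | no s∉S = contradiction s∈S s∉S

  same-side⇒Conn : ∀ {x y} → side x ≡ side y → Conn G A x y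
  same-side⇒Conn {x} {y} e = Conn-trans (Conn-end x) (subst (λ z → Conn G A z y) (cong endOn (sym e)) (Conn-sym (Conn-end y)))

  two-components : HasComponents G A 2
  two-components = side , onto , λ x y → mk⇔ same-side⇒Conn (Conn-invariant side side-edge)
    where
    onto : ∀ k → ∃ λ x → side x ≡ k
    onto zero = s , side-s
      where side-s : side s ≡ zero
            side-s with S? s
            ... | yes _ = refl
            ... | no s∉S = contradiction s∈S s∉S
    onto (suc zero) = w , side-w
      where side-w : side w ≡ suc zero
            side-w with S? w
            ... | yes w∈S = contradiction w∈S w∉S
            ... | no _ = refl

  not-dense : m G ≡ suc (n G) → ¬ UniformlyDense G
  not-dense m≡ dense = bridge-dense-arith k (subst₂ _≤_ (cong₂ _*_ ∣A∣≡k+2 (cong (_∸ 1) n≡)) (cong₂ _*_ (trans m≡ (cong suc n≡)) (cong (_∸ 2) n≡)) density)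
    where
    k = n G ∸ 2
    n≡ : n G ≡ suc (suc k)
    n≡ = sym (m+[n∸m]≡n (distinct⇒2≤ {k = n G} (λ s≡w → w∉S (subst S s≡w s∈S))))
    ∣A∣≡k+2 : ∣ A ∣ ≡ suc (suc k)
    ∣A∣≡k+2 = trans ∣A∣≡ (trans (cong (_∸ 1) m≡) n≡)
    density = dense A (nth A (subst Fin (sym ∣A∣≡k+2) zero) , nth-∈ A _) 2 1 two-components (connected⇒one-component connected s)

first-failure : (P : ℕ → Set) → (∀ j → Dec (P j)) → ∀ N →
  (∃ λ K → 1 ≤ K × K ≤ N × ¬ P K × (∀ j → 1 ≤ j → j < K → P j)) ⊎ (∀ j → 1 ≤ j → j ≤ N → P j)
first-failure P P? zero = inj₂ λ j 1≤j j≤0 → contradiction (≤-trans 1≤j j≤0) λ ()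
first-failure P P? (suc N) with first-failure P P? N
... | inj₁ (K , 1≤K , K≤N , ¬PK , below) = inj₁ (K , 1≤K , m≤n⇒m≤1+n K≤N , ¬PK , below)
... | inj₂ upto-N with P? (suc N)
...   | no ¬P = inj₁ (suc N , s≤s z≤n , ≤-refl , ¬P , λ j 1≤j j<1+N → upto-N j 1≤j (≤-pred j<1+N))
...   | yes P[1+N] = inj₂ λ j 1≤j j≤1+N → [ (λ j<1+N → upto-N j 1≤j (≤-pred j<1+N)) , (λ { refl → P[1+N] }) ]′
                                              (m≤n⇒m<n∨m≡n j≤1+N)

-- Vertices satisfying Through have exactly two incident edges, and `next w e` is
-- the one that is not e.  A trail starts at a vertex along one of its edges and keeps
-- going through such vertices until it stops at a vertex that is not Through.
module Trails (G : Graph) (simple : Simple G)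
  {Through : Fin (n G) → Set} (through? : ∀ w → Dec (Through w))
  (next : Fin (n G) → Fin (m G) → Fin (m G))
  (next-incident : ∀ {w e} → Incident G e w → Incident G (next w e) w)
  (next-≢ : ∀ {w e} → Through w → Incident G e w → next w e ≢ e)
  (next-only : ∀ {w e e′} → Through w → Incident G e w → Incident G e′ w → e′ ≡ e ⊎ e′ ≡ next w e) where
  open GraphLemmas G

  Dart : Set
  Dart = Σ (Fin (n G) × Fin (m G)) λ (w , e) → Incident G e w

  advance : Dart → Dart
  advance ((w , e) , inc) = (y , next y e) , next-incident (Joins⇒Incidentʳ (proj₂ (Incident⇒Joins inc)))
    where y = proj₁ (Incident⇒Joins inc)

  module Trail {b : Fin (n G)} (b-stops : ¬ Through b) {d : Fin (m G)} (d-at-b : Incident G d b) where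

    dart : ℕ → Dart
    dart zero = (b , d) , d-at-b
    dart (suc k) = advance (dart k)

    W : ℕ → Fin (n G)
    W k = proj₁ (proj₁ (dart k))

    Ed : ℕ → Fin (m G)
    Ed k = proj₂ (proj₁ (dart k))

    Ed-joins : ∀ k → Joins G (Ed k) (W k) (W (suc k))
    Ed-joins k = proj₂ (Incident⇒Joins (proj₂ (dart k)))

    Ed-incident : ∀ k → Incident G (Ed k) (W k)
    Ed-incident k = proj₂ (dart k)

    Ed-incident-next : ∀ k → Incident G (Ed k) (W (suc k))
    Ed-incident-next k = Joins⇒Incidentʳ (Ed-joins k)

    through-step : ∀ k → Through (W (suc k)) →
      Ed (suc k) ≢ Ed k × (∀ e → Incident G e (W (suc k)) → e ≡ Ed k ⊎ e ≡ Ed (suc k))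
    through-step k t = next-≢ t (Ed-incident-next k) , λ e → next-only t (Ed-incident-next k)

    ThroughBelow : ℕ → Set
    ThroughBelow J = ∀ j → 1 ≤ j → j < J → Through (W j)

    DistinctBelow : ℕ → Set
    DistinctBelow J = ∀ i i′ → i < i′ → i′ < J → W i ≢ W i′

    -- W j = W i entering along Ed (j-1), one of the two edges Ed (i-1), Ed i at W i,
    -- forces an earlier repetition, a loop, or an immediate reversal.
    first-repeat-at-start : ∀ i j → i < j → ThroughBelow j → DistinctBelow j → W i ≡ W j → i ≡ 0
    first-repeat-at-start i (suc j′) i<j through distinct eq with m≤n⇒m<n∨m≡n (≤-pred i<j)
    ... | inj₂ refl = contradiction (subst (λ t → Joins G (Ed j′) t (W (suc j′))) eq (Ed-joins j′)) (no-loop (proj₁ simple))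
    ... | inj₁ i<j′ with i
    ...   | zero = refl
    ...   | suc i′ with through-step i′ (through (suc i′) (s≤s z≤n) i<j)
    ...     | _ , only with only (Ed j′) (subst (Incident G (Ed j′)) (sym eq) (Ed-incident-next j′))
    ...       | inj₁ e with Joins-unique (Ed-joins j′) (subst (λ t → Joins G t (W i′) (W (suc i′))) (sym e) (Ed-joins i′))
    ...         | inj₁ (a , _) = contradiction (sym a) (distinct i′ j′ (<-trans (n<1+n i′) i<j′) (n<1+n j′))
    ...         | inj₂ (a , _) = contradiction (sym a) (distinct (suc i′) j′ i<j′ (n<1+n j′))
    first-repeat-at-start i (suc j′) i<j through distinct eq | inj₁ i<j′ | suc i′ | _ , only | inj₂ e
        with Joins-unique (Ed-joins j′) (subst (λ t → Joins G t (W (suc i′)) (W (suc (suc i′)))) (sym e) (Ed-joins (suc i′)))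
    ...         | inj₁ (a , _) = contradiction (sym a) (distinct (suc i′) j′ i<j′ (n<1+n j′))
    ...         | inj₂ (a , _) with m≤n⇒m<n∨m≡n i<j′
    ...           | inj₁ lt = contradiction (sym a) (distinct (suc (suc i′)) j′ lt (n<1+n j′))
    ...           | inj₂ refl = contradiction e (proj₁ (through-step (suc i′) (through (suc (suc i′)) (s≤s z≤n) (n<1+n _))))

    ThroughBelow-pred : ∀ {J} → ThroughBelow (suc J) → ThroughBelow J
    ThroughBelow-pred through j 1≤j j<J = through j 1≤j (m≤n⇒m≤1+n j<J)

    through⇒distinct : ∀ J → ThroughBelow J → DistinctBelow J
    through⇒distinct zero _ i i′ _ ()
    through⇒distinct (suc J) through i i′ i<i′ i′<1+J eq with m≤n⇒m<n∨m≡n (≤-pred i′<1+J)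
    ... | inj₁ i′<J = through⇒distinct J (ThroughBelow-pred through) i i′ i<i′ i′<J eq
    ... | inj₂ refl with first-repeat-at-start i i′ i<i′ (ThroughBelow-pred through)
                           (through⇒distinct i′ (ThroughBelow-pred through)) eq
    ...   | refl = b-stops (subst Through (sym eq) (through i′ i<i′ ≤-refl))

    -- W 0, …, W (n G) cannot all be distinct
    abstract
      stopping : Σ ℕ λ K → 1 ≤ K × ¬ Through (W K) × ThroughBelow K
      stopping with first-failure (Through ∘ W) (through? ∘ W) (n G)
      ... | inj₁ (K , 1≤K , _ , stops , below) = K , 1≤K , stops , below
      ... | inj₂ all-through = ⊥-elim (1+n≰n (injective⇒≤ {f = W ∘ toℕ} W-injective))
        where
        distinct : DistinctBelow (suc (n G))
        distinct = through⇒distinct (suc (n G)) λ j 1≤j j<1+n → all-through j 1≤j (≤-pred j<1+n)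
        W-injective : Injection {A = Fin (suc (n G))} (W ∘ toℕ)
        W-injective {i} {j} e with <-cmp (toℕ i) (toℕ j)
        ... | tri< lt _ _ = ⊥-elim (distinct _ _ lt (toℕ<n j) e)
        ... | tri≈ _ eq _ = toℕ-injective eq
        ... | tri> _ _ gt = ⊥-elim (distinct _ _ gt (toℕ<n i) (sym e))

    K : ℕ
    K = proj₁ stopping

    1≤K : 1 ≤ K
    1≤K = proj₁ (proj₂ stopping)

    stops-at-K : ¬ Through (W K)
    stops-at-K = proj₁ (proj₂ (proj₂ stopping))

    through-before-K : ThroughBelow K
    through-before-K = proj₂ (proj₂ (proj₂ stopping))

    repeat⇒ends : ∀ i i′ → i < i′ → i′ ≤ K → W i ≡ W i′ → i ≡ 0 × i′ ≡ K
    repeat⇒ends i i′ i<i′ i′≤K eq with m≤n⇒m<n∨m≡n i′≤K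
    ... | inj₁ i′<K = contradiction eq (through⇒distinct K through-before-K i i′ i<i′ i′<K)
    ... | inj₂ refl = first-repeat-at-start i i′ i<i′ through-before-K (through⇒distinct K through-before-K) eq , refl

    stops⇒end : ∀ i → i ≤ K → ¬ Through (W i) → i ≡ 0 ⊎ i ≡ K
    stops⇒end zero _ _ = inj₁ refl
    stops⇒end (suc i) i≤K stops with m≤n⇒m<n∨m≡n i≤K
    ... | inj₁ i<K = contradiction (through-before-K (suc i) (s≤s z≤n) i<K) stops
    ... | inj₂ e = inj₂ e

    Ed-distinct : ∀ i i′ → i < i′ → i′ < K → Ed i ≢ Ed i′
    Ed-distinct i i′ lt lt′ e with Joins-unique (Ed-joins i) (subst (λ t → Joins G t (W i′) (W (suc i′))) (sym e) (Ed-joins i′))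
    ... | inj₁ (a , _) = <⇒≢ lt′ (proj₂ (repeat⇒ends i i′ lt (<⇒≤ lt′) a))
    ... | inj₂ (_ , a) with m≤n⇒m<n∨m≡n lt
    ...   | inj₁ lt2 = contradiction (proj₁ (repeat⇒ends (suc i) i′ lt2 (<⇒≤ lt′) a)) λ ()
    ...   | inj₂ refl = proj₁ (through-step i (through-before-K (suc i) (s≤s z≤n) lt′)) (sym e)

    Ed-injective : ∀ i i′ → i < K → i′ < K → Ed i ≡ Ed i′ → i ≡ i′
    Ed-injective i i′ i<K i′<K e with <-cmp i i′
    ... | tri< lt _ _ = contradiction e (Ed-distinct i i′ lt i′<K)
    ... | tri≈ _ eq _ = eq
    ... | tri> _ _ gt = contradiction (sym e) (Ed-distinct i′ i gt i<K)

    pathTo : ∀ {v} → W K ≡ v → Path G b v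
    pathTo WK≡v = record
      { len = K ; vert = W ∘ toℕ ; edge = Ed ∘ toℕ ; start = refl
      ; stop = trans (cong W (toℕ-fromℕ K)) WK≡v
      ; joins = λ i → subst (λ t → Joins G (Ed (toℕ i)) (W t) (W (suc (toℕ i)))) (sym (toℕ-inject₁ i)) (Ed-joins (toℕ i))
      ; dist = distinct }
      where
      distinct : ∀ (i j : Fin (suc K)) → W (toℕ i) ≡ W (toℕ j) → i ≡ j ⊎ (EndPos K i × EndPos K j)
      distinct i j e with <-cmp (toℕ i) (toℕ j)
      ... | tri< lt _ _ = let i≡0 , j≡K = repeat⇒ends _ _ lt (≤-pred (toℕ<n j)) e in inj₂ (inj₁ i≡0 , inj₂ j≡K)
      ... | tri≈ _ eq _ = inj₁ (toℕ-injective eq)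
      ... | tri> _ _ gt = let j≡0 , i≡K = repeat⇒ends _ _ gt (≤-pred (toℕ<n i)) (sym e) in inj₂ (inj₂ i≡K , inj₁ j≡0)

    pred-K<K : pred K < K
    pred-K<K = subst (pred K <_) (suc-pred K {{>-nonZero 1≤K}}) ≤-refl

    last-incident : Incident G (Ed (pred K)) (W K)
    last-incident = subst (Incident G (Ed (pred K)) ∘ W) (suc-pred K {{>-nonZero 1≤K}}) (Ed-incident-next (pred K))

    closed⇒last≢first : W K ≡ b → Ed (pred K) ≢ d
    closed⇒last≢first WK≡b e with Ed-injective (pred K) 0 pred-K<K 1≤K e
    ... | pred-K≡0 = no-loop (proj₁ simple) (subst (Joins G d b) (trans (cong W (sym K≡1)) WK≡b) (Ed-joins 0))
      where K≡1 = trans (sym (suc-pred K {{>-nonZero 1≤K}})) (cong suc pred-K≡0)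

    inner-incident : ∀ i → 1 ≤ i → i < K → ∀ e → Incident G e (W i) → e ≡ Ed (pred i) ⊎ e ≡ Ed i
    inner-incident (suc i) _ i<K = proj₂ (through-step i (through-before-K (suc i) (s≤s z≤n) i<K))

  -- Two trails starting at stopping vertices that share an edge are the same trail,
  -- possibly traversed backwards.
  module TwoTrails {b} (b-stops : ¬ Through b) {d} (d-at-b : Incident G d b)
                   {c} (c-stops : ¬ Through c) {d′} (d′-at-c : Incident G d′ c) where
    module T₁ = Trail b-stops d-at-b
    module T₂ = Trail c-stops d′-at-c

    SameTrail : Set
    SameTrail = (c ≡ b × d′ ≡ d) ⊎ (c ≡ T₁.W T₁.K × d′ ≡ T₁.Ed (pred T₁.K))

    shared-edge⇒same : ∀ j i → j < T₂.K → i < T₁.K → T₂.Ed j ≡ T₁.Ed i → SameTrail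
    shared-edge⇒same zero i _ i<K e with Joins-Incident (T₁.Ed-joins i) (subst (λ t → Incident G t c) e d′-at-c)
    ... | inj₁ c≡Wi with T₁.stops⇒end i (<⇒≤ i<K) (c-stops ∘ subst Through (sym c≡Wi))
    ...   | inj₁ refl = inj₁ (c≡Wi , e)
    ...   | inj₂ refl = contradiction i<K (<-irrefl refl)
    shared-edge⇒same zero i _ i<K e | inj₂ c≡W1+i with T₁.stops⇒end (suc i) i<K (c-stops ∘ subst Through (sym c≡W1+i))
    ...   | inj₂ 1+i≡K = inj₂ (trans c≡W1+i (cong T₁.W 1+i≡K) , trans e (cong (T₁.Ed ∘ pred) 1+i≡K))
    shared-edge⇒same (suc j) i 1+j<K i<K e with T₂.through-step j through₂
      where through₂ = T₂.through-before-K (suc j) (s≤s z≤n) 1+j<K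
    ... | Ed≢ , _ with Joins-Incident (T₁.Ed-joins i) (subst (λ t → Incident G t (T₂.W (suc j))) e (T₂.Ed-incident (suc j)))
    ...   | inj₁ W≡Wi with i
    ...     | zero = ⊥-elim (b-stops (subst Through W≡Wi through₂))
      where through₂ = T₂.through-before-K (suc j) (s≤s z≤n) 1+j<K
    ...     | suc i′ with T₁.through-step i′ (subst Through W≡Wi (T₂.through-before-K (suc j) (s≤s z≤n) 1+j<K))
    ...       | _ , only with only (T₂.Ed j) (subst (Incident G (T₂.Ed j)) W≡Wi (T₂.Ed-incident-next j))
    ...         | inj₁ q = shared-edge⇒same j i′ (<-trans (n<1+n j) 1+j<K) (<-trans (n<1+n i′) i<K) q
    ...         | inj₂ q = contradiction (trans e (sym q)) Ed≢
    shared-edge⇒same (suc j) i 1+j<K i<K e | Ed≢ , _ | inj₂ W≡W1+i with m≤n⇒m<n∨m≡n i<K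
    ...     | inj₂ 1+i≡K = ⊥-elim (T₁.stops-at-K (subst Through (trans W≡W1+i (cong T₁.W 1+i≡K)) (T₂.through-before-K (suc j) (s≤s z≤n) 1+j<K)))
    ...     | inj₁ 1+i<K with T₁.through-step i (subst Through W≡W1+i (T₂.through-before-K (suc j) (s≤s z≤n) 1+j<K))
    ...       | _ , only with only (T₂.Ed j) (subst (Incident G (T₂.Ed j)) W≡W1+i (T₂.Ed-incident-next j))
    ...         | inj₁ q = contradiction (trans e (sym q)) Ed≢
    ...         | inj₂ q = shared-edge⇒same j (suc i) (<-trans (n<1+n j) 1+j<K) 1+i<K q

    shared-inner⇒same : ∀ i j → 1 ≤ i → i < T₁.K → 1 ≤ j → j < T₂.K → T₁.W i ≡ T₂.W j → SameTrail
    shared-inner⇒same (suc i) j _ i<K _ j<K e with T₁.inner-incident (suc i) (s≤s z≤n) i<K (T₂.Ed j) (subst (Incident G (T₂.Ed j)) (sym e) (T₂.Ed-incident j))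
    ... | inj₁ q = shared-edge⇒same j i j<K (<-trans (n<1+n i) i<K) q
    ... | inj₂ q = shared-edge⇒same j (suc i) j<K i<K q

  module SameStart {b} (b-stops : ¬ Through b) {d d′} (d-at-b : Incident G d b) (d′-at-b : Incident G d′ b) where
    open TwoTrails b-stops d-at-b b-stops d′-at-b public

    share-only-ends : ∀ {v} (e₁ : T₁.W T₁.K ≡ v) (e₂ : T₂.W T₂.K ≡ v) → ¬ SameTrail →
                      ShareOnlyEnds (T₁.pathTo e₁) (T₂.pathTo e₂)
    share-only-ends e₁ e₂ different w (i , refl) (j , Wj≡w) with toℕ i ≟ 0 | toℕ i ≟ T₁.K
    ... | yes i≡0 | _ = inj₁ (cong T₁.W i≡0)
    ... | no _ | yes i≡K = inj₂ (trans (cong T₁.W i≡K) e₁)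
    ... | no i≢0 | no i≢K with toℕ j ≟ 0 | toℕ j ≟ T₂.K
    ...   | yes j≡0 | _ = inj₁ (trans (sym Wj≡w) (cong T₂.W j≡0))
    ...   | no _ | yes j≡K = inj₂ (trans (sym Wj≡w) (trans (cong T₂.W j≡K) e₂))
    ...   | no j≢0 | no j≢K = contradiction
            (shared-inner⇒same (toℕ i) (toℕ j) (n≢0⇒n>0 i≢0) (≤∧≢⇒< (≤-pred (toℕ<n i)) i≢K)
                               (n≢0⇒n>0 j≢0) (≤∧≢⇒< (≤-pred (toℕ<n j)) j≢K) (sym Wj≡w)) different

Sorted : ∀ {G} → Theta G → Set
Sorted t = L₁ ≤ L₂ × L₂ ≤ L₃
  where open Theta t

sort : ∀ {G} → Theta G → Σ (Theta G) Sorted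
sort t = third (second (first t))
  where
  open Theta using (L₁; L₂; L₃)
  first : ∀ t → Σ _ λ t′ → L₁ t′ ≤ L₂ t′
  first t with L₁ t ≤? L₂ t
  ... | yes ≤ = t , ≤
  ... | no ≰ = swapXY t , <⇒≤ (≰⇒> ≰)
  second : (Σ _ λ t → L₁ t ≤ L₂ t) → Σ _ λ t → Sorted t ⊎ (L₁ t ≤ L₃ t × L₂ t ≤ L₃ t)
  second (t , X≤Y) with L₂ t ≤? L₃ t
  ... | yes Y≤Z = t , inj₁ (X≤Y , Y≤Z)
  ... | no ≰ = swapYZ t , inj₂ (X≤Y , <⇒≤ (≰⇒> ≰))
  third : (Σ _ λ t → Sorted t ⊎ (L₁ t ≤ L₃ t × L₂ t ≤ L₃ t)) → Σ _ Sorted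
  third (t , inj₁ sorted) = t , sorted
  third (t , inj₂ (X≤Z , Y≤Z)) with L₁ t ≤? L₂ t
  ... | yes X≤Y = t , X≤Y , Y≤Z
  ... | no ≰ = swapXY t , <⇒≤ (≰⇒> ≰) , X≤Z

-- s = L₁ + L₂, t = L₃: the density inequality for the edges of X and Y forces t ≤ s
balance-arith : ∀ s t a n → 1 ≤ s → s ≤ a → s + t ≡ suc n → a * (n ∸ 1) ≤ suc n * (n ∸ t) → t ≤ s
balance-arith (suc s) zero a n _ _ _ _ = z≤n
balance-arith (suc s) (suc t) a n _ 1+s≤a e dense = s≤s (+-cancelˡ-≤ ((suc s + suc t) * s) t s (begin
  (suc s + suc t) * s + t    ≡⟨ expand s t ⟨
  suc s * (s + t) + s        ≤⟨ +-monoˡ-≤ s lhs≤ ⟩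
  (suc s + suc t) * s + s    ∎))
  where
  open ≤-Reasoning
  expand : ∀ s t → suc s * (s + t) + s ≡ (suc s + suc t) * s + t
  expand = solve-∀
  n≡ : n ≡ suc (s + t)
  n≡ = suc-injective (trans (sym e) (cong suc (+-suc s t)))
  lhs≤ : suc s * (s + t) ≤ (suc s + suc t) * s
  lhs≤ = begin
    suc s * (s + t)            ≤⟨ *-monoˡ-≤ (s + t) 1+s≤a ⟩
    a * (s + t)                ≡⟨ cong (λ k → a * (k ∸ 1)) n≡ ⟨
    a * (n ∸ 1)                ≤⟨ dense ⟩
    suc n * (n ∸ suc t)        ≡⟨ cong₂ _*_ (sym e) (trans (cong (_∸ suc t) (trans n≡ (sym (+-suc s t)))) (m+n∸n≡m s (suc t))) ⟩
    (suc s + suc t) * s        ∎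

-- The edges of X and Y form one component together with everything off the interior
-- of Z; each interior vertex of Z is a component of its own, so there are L₃ of them.
module XYComponents {G : Graph} (connected : Connected G) (t : Theta G) (0<L₃ : 0 < Theta.L₃ t) where
  open Theta t
  open GraphLemmas G

  onXY : Fin L₁ ⊎ Fin L₂ ⊎ Fin L₃ → Bool
  onXY (inj₂ (inj₂ _)) = false
  onXY _ = true

  position : Fin (m G) → Fin L₁ ⊎ Fin L₂ ⊎ Fin L₃
  position e = proj₁ (edges-onto e)

  A : Subset (m G)
  A = tabulate (onXY ∘ position)

  ∈A⇔ : ∀ {e} → e ∈ A ⇔ onXY (position e) ≡ true
  ∈A⇔ {e} = mk⇔ (λ e∈A → trans (sym (lookup∘tabulate _ e)) ([]=⇒lookup e∈A))
                (λ on → lookup⇒[]= e A (trans (lookup∘tabulate _ e) on))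

  position-EdgeOf3 : ∀ p → position (EdgeOf3 X Y Z p) ≡ p
  position-EdgeOf3 p = edges-injective (proj₂ (edges-onto _))

  X⊆A : ∀ j → edge X j ∈ A
  X⊆A j = Equivalence.from ∈A⇔ (cong onXY (position-EdgeOf3 (inj₁ j)))

  Y⊆A : ∀ j → edge Y j ∈ A
  Y⊆A j = Equivalence.from ∈A⇔ (cong onXY (position-EdgeOf3 (inj₂ (inj₁ j))))

  L₁+L₂≤∣A∣ : L₁ + L₂ ≤ ∣ A ∣
  L₁+L₂≤∣A∣ = injective⊎⇒≤∣∣ A ([ edge X , edge Y ]′) XY-injective
                λ { (inj₁ j) → X⊆A j ; (inj₂ j) → Y⊆A j }
    where
    XY-injective : Injection [ edge X , edge Y ]′
    XY-injective {inj₁ a} {inj₁ b} e = cong inj₁ (inj₁-injective (edges-injective {inj₁ a} {inj₁ b} e))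
    XY-injective {inj₁ a} {inj₂ b} e with () ← edges-injective {inj₁ a} {inj₂ (inj₁ b)} e
    XY-injective {inj₂ a} {inj₁ b} e with () ← edges-injective {inj₂ (inj₁ a)} {inj₁ b} e
    XY-injective {inj₂ a} {inj₂ b} e = cong inj₂ (inj₁-injective (inj₂-injective (edges-injective {inj₂ (inj₁ a)} {inj₂ (inj₁ b)} e)))

  InnerZ : Fin (n G) → Set
  InnerZ w = Σ (Fin (suc L₃)) λ i → vert Z i ≡ w × 0 < toℕ i × toℕ i < L₃

  innerZ? : ∀ w → Dec (InnerZ w)
  innerZ? w = any? λ i → (vert Z i F.≟ w) ×-dec ((0 <? toℕ i) ×-dec (toℕ i <? L₃))

  component : Fin (n G) → Fin L₃
  component w with innerZ? w
  ... | yes (i , _ , _ , i<L₃) = fromℕ< i<L₃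
  ... | no _ = fromℕ< 0<L₃

  component-outer : ∀ {w} → ¬ InnerZ w → toℕ (component w) ≡ 0
  component-outer {w} outer with innerZ? w
  ... | yes inner = contradiction inner outer
  ... | no _ = toℕ-fromℕ< 0<L₃

  component-inner : ∀ {w} ((i , _) : InnerZ w) → toℕ (component w) ≡ toℕ i
  component-inner {w} (i , Zi≡w , 0<i , i<L₃) with innerZ? w
  ... | no outer = contradiction (i , Zi≡w , 0<i , i<L₃) outer
  ... | yes (j , Zj≡w , 0<j , j<L₃) with dist Z j i (trans Zj≡w (sym Zi≡w))
  ...   | inj₁ refl = toℕ-fromℕ< j<L₃
  ...   | inj₂ (inj₁ j≡0 , _) = contradiction (sym j≡0) (<⇒≢ 0<j)
  ...   | inj₂ (inj₂ j≡L₃ , _) = contradiction j≡L₃ (<⇒≢ j<L₃)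

  InnerZ⇒≢ends : ∀ {w} → InnerZ w → w ≢ u × w ≢ v
  InnerZ⇒≢ends (i , Zi≡w , 0<i , i<L₃) =
    (λ w≡u → not-end zero (inj₁ refl) (dist Z i zero (trans Zi≡w (trans w≡u (sym (start Z)))))) ,
    (λ w≡v → not-end (fromℕ L₃) (inj₂ (toℕ-fromℕ L₃)) (dist Z i (fromℕ L₃) (trans Zi≡w (trans w≡v (sym (stop Z))))))
    where
    inner : ¬ EndPos L₃ i
    inner (inj₁ i≡0) = <⇒≢ 0<i (sym i≡0)
    inner (inj₂ i≡L₃) = <⇒≢ i<L₃ i≡L₃
    not-end : ∀ j → EndPos L₃ j → ¬ (i ≡ j ⊎ (EndPos L₃ i × EndPos L₃ j))
    not-end j j-end (inj₁ refl) = inner j-end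
    not-end j _ (inj₂ (i-end , _)) = inner i-end

  XY⇒outer : ∀ {w} → OnPath w X ⊎ OnPath w Y → ¬ InnerZ w
  XY⇒outer {w} on-XY inner@(j , Zj≡w , _) with share on-XY (j , Zj≡w)
    where
    share : OnPath w X ⊎ OnPath w Y → OnPath w Z → w ≡ u ⊎ w ≡ v
    share (inj₁ on-X) = X∩Z w on-X
    share (inj₂ on-Y) = Y∩Z w on-Y
  ... | inj₁ w≡u = proj₁ (InnerZ⇒≢ends inner) w≡u
  ... | inj₂ w≡v = proj₂ (InnerZ⇒≢ends inner) w≡v

  full-Conn-u : ∀ (P : Path G u v) → (∀ j → edge P j ∈ A) → ∀ i → Conn G A (vert P i) u
  full-Conn-u P full i with walk-to-start P A i
  ... | inj₁ c = c
  ... | inj₂ (j , _ , j∉A , _) = contradiction (full j) j∉A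

  outer-Conn-u : ∀ w → ¬ InnerZ w → Conn G A w u
  outer-Conn-u w outer with covers w
  ... | inj₁ (i , refl) = full-Conn-u X X⊆A i
  ... | inj₂ (inj₁ (i , refl)) = full-Conn-u Y Y⊆A i
  ... | inj₂ (inj₂ (i , refl)) with toℕ i ≟ 0 | toℕ i ≟ L₃
  ...   | yes i≡0 | _ = ≡⇒Conn (trans (cong (vert Z) (toℕ-injective {j = zero} i≡0)) (start Z))
  ...   | no _ | yes i≡L₃ = subst (λ x → Conn G A x u) v≡Zi (full-Conn-u X X⊆A (fromℕ L₁))
    where v≡Zi = trans (stop X) (sym (trans (cong (vert Z) (toℕ-injective (trans i≡L₃ (sym (toℕ-fromℕ L₃))))) (stop Z)))
  ...   | no i≢0 | no i≢L₃ = contradiction (i , refl , n≢0⇒n>0 i≢0 , ≤∧≢⇒< (≤-pred (toℕ<n i)) i≢L₃) outer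

  A-edge⇒outer : ∀ {i x y} → i ∈ A → Joins G i x y → ¬ InnerZ x × ¬ InnerZ y
  A-edge⇒outer {i} i∈A x~y with position i | proj₂ (edges-onto i) | Equivalence.to ∈A⇔ i∈A
  ... | inj₁ j | refl | _ = let x-on , y-on = edge-ends-on X j x~y in XY⇒outer (inj₁ x-on) , XY⇒outer (inj₁ y-on)
  ... | inj₂ (inj₁ j) | refl | _ = let x-on , y-on = edge-ends-on Y j x~y in XY⇒outer (inj₂ x-on) , XY⇒outer (inj₂ y-on)

  components : HasComponents G A L₃
  components = component , onto , λ x y → mk⇔ same⇒Conn (Conn-invariant component same-edge)
    where
    onto : ∀ k → ∃ λ x → component x ≡ k
    onto k with toℕ k ≟ 0
    ... | yes k≡0 = u , toℕ-injective (trans (component-outer (λ inner → proj₁ (InnerZ⇒≢ends inner) refl)) (sym k≡0))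
    ... | no k≢0 = vert Z (inject₁ k) , toℕ-injective (trans (component-inner inner) (toℕ-inject₁ k))
      where
      inner : InnerZ (vert Z (inject₁ k))
      inner = inject₁ k , refl , subst (0 <_) (sym (toℕ-inject₁ k)) (n≢0⇒n>0 k≢0) , subst (_< L₃) (sym (toℕ-inject₁ k)) (toℕ<n k)
    same-edge : ∀ {i x y} → i ∈ A → Joins G i x y → component x ≡ component y
    same-edge i∈A x~y = let x-out , y-out = A-edge⇒outer i∈A x~y in
      toℕ-injective (trans (component-outer x-out) (sym (component-outer y-out)))
    same⇒Conn : ∀ {x y} → component x ≡ component y → Conn G A x y
    same⇒Conn {x} {y} e = by-cases (innerZ? x) (innerZ? y)
     where
     by-cases : Dec (InnerZ x) → Dec (InnerZ y) → Conn G A x y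
     by-cases (yes x-in) (yes y-in) = ≡⇒Conn (trans (sym (proj₁ (proj₂ x-in))) (trans (cong (vert Z) i≡j) (proj₁ (proj₂ y-in))))
       where i≡j = toℕ-injective (trans (sym (component-inner x-in)) (trans (cong toℕ e) (component-inner y-in)))
     by-cases (yes x-in) (no y-out) = contradiction (trans (sym (component-inner x-in)) (trans (cong toℕ e) (component-outer y-out)))
                                               (≢-sym (<⇒≢ (proj₁ (proj₂ (proj₂ x-in)))))
     by-cases (no x-out) (yes y-in) = contradiction (trans (sym (component-inner y-in)) (trans (cong toℕ (sym e)) (component-outer x-out)))
                                               (≢-sym (<⇒≢ (proj₁ (proj₂ (proj₂ y-in)))))
     by-cases (no x-out) (no y-out) = Conn-trans (outer-Conn-u x x-out) (Conn-sym (outer-Conn-u y y-out))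

Sorted⇒Balanced : ∀ {G} → Connected G → m G ≡ suc (n G) → UniformlyDense G → (t : Theta G) → Sorted t → Balanced t
Sorted⇒Balanced {G} connected m≡ dense t (X≤Y , Y≤Z) = X≤Y , Y≤Z , m≤n+o⇒m∸n≤o L₃ L₂ (≤-trans Z≤X+Y (≤-reflexive (+-comm L₁ L₂)))
  where
  open Theta t
  open GraphLemmas G using (connected⇒one-component)
  open XYComponents connected t (<-≤-trans (0<L₂ m≡ X≤Y) Y≤Z)
  Z≤X+Y : L₃ ≤ L₁ + L₂
  Z≤X+Y = balance-arith (L₁ + L₂) L₃ ∣ A ∣ (n G) (0<L₁+L₂ m≡) L₁+L₂≤∣A∣ (trans (+-assoc L₁ L₂ L₃) (trans sum-of-lengths m≡))
            (subst (λ M → ∣ A ∣ * (n G ∸ 1) ≤ M * (n G ∸ L₃)) m≡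
              (dense A (edge Y y₀ , Y⊆A y₀) L₃ 1 components (connected⇒one-component connected u)))
    where y₀ = fromℕ< (0<L₂ m≡ X≤Y)

third : (a b : Fin 3) → a ≢ b → ∃ λ c → c ≢ a × c ≢ b
third zero zero a≢b = contradiction refl a≢b
third zero (suc zero) _ = suc (suc zero) , (λ ()) , (λ ())
third zero (suc (suc zero)) _ = suc zero , (λ ()) , (λ ())
third (suc zero) zero _ = suc (suc zero) , (λ ()) , (λ ())
third (suc zero) (suc zero) a≢b = contradiction refl a≢b
third (suc zero) (suc (suc zero)) _ = zero , (λ ()) , (λ ())
third (suc (suc zero)) zero _ = suc zero , (λ ()) , (λ ())
third (suc (suc zero)) (suc zero) _ = zero , (λ ()) , (λ ())
third (suc (suc zero)) (suc (suc zero)) a≢b = contradiction refl a≢b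

cover₃ : ∀ {a b c : Fin 3} → a ≢ b → a ≢ c → b ≢ c → ∀ k → k ≡ a ⊎ k ≡ b ⊎ k ≡ c
cover₃ {a} {b} {c} a≢b a≢c b≢c k with injective⇒onto abc abc-injective k
  where
  abc : Fin 3 → Fin 3
  abc zero = a
  abc (suc zero) = b
  abc (suc (suc zero)) = c
  abc-injective : Injection abc
  abc-injective {zero} {zero} _ = refl
  abc-injective {zero} {suc zero} e = contradiction e a≢b
  abc-injective {zero} {suc (suc zero)} e = contradiction e a≢c
  abc-injective {suc zero} {zero} e = contradiction (sym e) a≢b
  abc-injective {suc zero} {suc zero} _ = refl
  abc-injective {suc zero} {suc (suc zero)} e = contradiction e b≢c
  abc-injective {suc (suc zero)} {zero} e = contradiction (sym e) a≢c
  abc-injective {suc (suc zero)} {suc zero} e = contradiction (sym e) b≢c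
  abc-injective {suc (suc zero)} {suc (suc zero)} _ = refl
... | zero , refl = inj₁ refl
... | suc zero , refl = inj₂ (inj₁ refl)
... | suc (suc zero) , refl = inj₂ (inj₂ refl)

cover₄ : ∀ {a b c d : Fin 4} → a ≢ b → a ≢ c → a ≢ d → b ≢ c → b ≢ d → c ≢ d →
         ∀ k → k ≡ a ⊎ k ≡ b ⊎ k ≡ c ⊎ k ≡ d
cover₄ {a} {b} {c} {d} a≢b a≢c a≢d b≢c b≢d c≢d k with injective⇒onto abcd abcd-injective k
  where
  abcd : Fin 4 → Fin 4
  abcd zero = a
  abcd (suc zero) = b
  abcd (suc (suc zero)) = c
  abcd (suc (suc (suc zero))) = d
  abcd-injective : Injection abcd
  abcd-injective {zero} {zero} _ = refl
  abcd-injective {zero} {suc zero} e = contradiction e a≢b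
  abcd-injective {zero} {suc (suc zero)} e = contradiction e a≢c
  abcd-injective {zero} {suc (suc (suc zero))} e = contradiction e a≢d
  abcd-injective {suc zero} {zero} e = contradiction (sym e) a≢b
  abcd-injective {suc zero} {suc zero} _ = refl
  abcd-injective {suc zero} {suc (suc zero)} e = contradiction e b≢c
  abcd-injective {suc zero} {suc (suc (suc zero))} e = contradiction e b≢d
  abcd-injective {suc (suc zero)} {zero} e = contradiction (sym e) a≢c
  abcd-injective {suc (suc zero)} {suc zero} e = contradiction (sym e) b≢c
  abcd-injective {suc (suc zero)} {suc (suc zero)} _ = refl
  abcd-injective {suc (suc zero)} {suc (suc (suc zero))} e = contradiction e c≢d
  abcd-injective {suc (suc (suc zero))} {zero} e = contradiction (sym e) a≢d
  abcd-injective {suc (suc (suc zero))} {suc zero} e = contradiction (sym e) b≢d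
  abcd-injective {suc (suc (suc zero))} {suc (suc zero)} e = contradiction (sym e) c≢d
  abcd-injective {suc (suc (suc zero))} {suc (suc (suc zero))} _ = refl
... | zero , refl = inj₁ refl
... | suc zero , refl = inj₂ (inj₁ refl)
... | suc (suc zero) , refl = inj₂ (inj₂ (inj₁ refl))
... | suc (suc (suc zero)) , refl = inj₂ (inj₂ (inj₂ refl))

module DenseGraph (G : Graph) (simple : Simple G) (connected : Connected G)
                  (m≡ : m G ≡ suc (n G)) (dense : UniformlyDense G) where
  open GraphLemmas G
  open Degrees G (proj₁ simple)

  has-edge : ∀ x → ∃ λ e → Incident G e x
  has-edge x with x F.≟ y | connected x y
    where y = proj₁ (ends G (subst Fin (sym m≡) zero))
  ... | yes refl | _ = _ , inj₁ refl
  ... | no x≢y | here = contradiction refl x≢y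
  ... | no _ | step i _ x~z _ = i , Joins⇒Incidentˡ x~z

  -- degree 0 contradicts connectivity, degree 1 makes the edge at x a bridge
  deg≥2 : ∀ x → 2 ≤ deg x
  deg≥2 x with deg x in deg≡ | has-edge x
  ... | suc (suc _) | _ = s≤s (s≤s z≤n)
  ... | zero | _ , inc = case subst Fin deg≡ (proj₁ (dart-onto inc)) of λ ()
  ... | suc zero | d , d-at-x = contradiction dense (NoBridge.not-dense G connected (λ w → w F.≟ x) d-joins refl y≢x stays m≡)
    where
    open DartsOf x deg≡
    only-d : ∀ {e} → Incident G e x → e ≡ d
    only-d inc with darts-onto inc | darts-onto d-at-x
    ... | zero , refl | zero , refl = refl
    y = proj₁ (Incident⇒Joins d-at-x)
    d-joins : Joins G d x y
    d-joins = proj₂ (Incident⇒Joins d-at-x)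
    y≢x : y ≢ x
    y≢x y≡x = no-loop (proj₁ simple) (subst (Joins G d x) y≡x d-joins)
    stays : ∀ {i a b} → i ≢ d → Joins G i a b → a ≡ x → b ≡ x
    stays i≢d a~b refl = contradiction (only-d (Joins⇒Incidentˡ a~b)) i≢d

  excess : Fin (n G) → ℕ
  excess x = deg x ∸ 2

  deg≡2+excess : ∀ x → deg x ≡ 2 + excess x
  deg≡2+excess x = sym (m+[n∸m]≡n (deg≥2 x))

  deg-with : ∀ x {k} → excess x ≡ k → deg x ≡ 2 + k
  deg-with x e = trans (deg≡2+excess x) (cong (2 +_) e)

  sum-excess : sum excess ≡ 2
  sum-excess = +-cancelˡ-≡ (n G * 2) (sum excess) 2 (begin
    n G * 2 + sum excess                ≡⟨ cong (_+ sum excess) (sum-const (n G) 2) ⟨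
    sum {n G} (λ _ → 2) + sum excess    ≡⟨ ∑-distrib-+ (λ _ → 2) excess ⟨
    sum (λ x → 2 + excess x)            ≡⟨ sum-cong-≗ deg≡2+excess ⟨
    sum deg                             ≡⟨ handshake ⟩
    m G * 2                             ≡⟨ cong (_* 2) m≡ ⟩
    suc (n G) * 2                       ≡⟨ +-comm 2 (n G * 2) ⟩
    n G * 2 + 2                         ∎)
    where open ≡-Reasoning

  Through : Fin (n G) → Set
  Through w = deg w ≡ 2

  other : Fin (m G) → Fin (m G) → Fin (m G) → Fin (m G)
  other a b e with e F.≟ a
  ... | yes _ = b
  ... | no _ = a

  other-≢ : ∀ {a b} e → a ≢ b → other a b e ≢ e
  other-≢ {a} e a≢b with e F.≟ a
  ... | yes refl = a≢b ∘ sym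
  ... | no e≢a = e≢a ∘ sym

  other-of-two : ∀ a b e → other a b e ≡ a ⊎ other a b e ≡ b
  other-of-two a b e with e F.≟ a
  ... | yes _ = inj₂ refl
  ... | no _ = inj₁ refl

  other-only : ∀ {a b e e′} → e ≡ a ⊎ e ≡ b → e′ ≡ a ⊎ e′ ≡ b → e′ ≡ e ⊎ e′ ≡ other a b e
  other-only {a} {b} {e} e∈ e′∈ with e F.≟ a
  other-only (inj₁ refl) (inj₁ refl) | yes _ = inj₁ refl
  other-only _ (inj₂ refl) | yes _ = inj₂ refl
  other-only (inj₂ refl) (inj₁ refl) | yes e≡a = inj₁ (sym e≡a)
  other-only (inj₁ refl) _ | no e≢a = contradiction refl e≢a
  other-only (inj₂ refl) (inj₁ refl) | no _ = inj₂ refl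
  other-only (inj₂ refl) (inj₂ refl) | no _ = inj₁ refl

  next : Fin (n G) → Fin (m G) → Fin (m G)
  next w e with deg w ≟ 2
  ... | yes deg≡2 = other (DartsOf.darts w deg≡2 zero) (DartsOf.darts w deg≡2 (suc zero)) e
  ... | no _ = e

  next-incident : ∀ {w e} → Incident G e w → Incident G (next w e) w
  next-incident {w} {e} e-at-w with deg w ≟ 2
  ... | no _ = e-at-w
  ... | yes deg≡2 with other-of-two (DartsOf.darts w deg≡2 zero) (DartsOf.darts w deg≡2 (suc zero)) e
  ...   | inj₁ ≡a = subst (λ e → Incident G e w) (sym ≡a) (DartsOf.darts-incident w deg≡2 zero)
  ...   | inj₂ ≡b = subst (λ e → Incident G e w) (sym ≡b) (DartsOf.darts-incident w deg≡2 (suc zero))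

  the-two : ∀ {w} (deg≡2 : deg w ≡ 2) {e} → Incident G e w →
            e ≡ DartsOf.darts w deg≡2 zero ⊎ e ≡ DartsOf.darts w deg≡2 (suc zero)
  the-two {w} deg≡2 e-at-w with DartsOf.darts-onto w deg≡2 e-at-w
  ... | zero , refl = inj₁ refl
  ... | suc zero , refl = inj₂ refl

  next-≢ : ∀ {w e} → Through w → Incident G e w → next w e ≢ e
  next-≢ {w} {e} through _ with deg w ≟ 2
  ... | no ¬through = contradiction through ¬through
  ... | yes deg≡2 = other-≢ e (λ a≡b → contradiction (DartsOf.darts-injective w deg≡2 a≡b) λ ())

  next-only : ∀ {w e e′} → Through w → Incident G e w → Incident G e′ w → e′ ≡ e ⊎ e′ ≡ next w e
  next-only {w} through e-at-w e′-at-w with deg w ≟ 2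
  ... | no ¬through = contradiction through ¬through
  ... | yes deg≡2 = other-only (the-two deg≡2 e-at-w) (the-two deg≡2 e′-at-w)

  open Trails G simple (λ w → deg w ≟ 2) next next-incident next-≢ next-only

  module FromBranch {u} (u-stops : ¬ Through u) {N} (deg≡N : deg u ≡ N) where
    open DartsOf u deg≡N public
    module T (a : Fin N) = Trail u-stops (darts-incident a)
    module Pair (a b : Fin N) = SameStart u-stops (darts-incident a) (darts-incident b)

    OnTrail : Fin N → Fin (n G) → Set
    OnTrail a w = ∃ λ (i : Fin (suc (T.K a))) → T.W a (toℕ i) ≡ w

    on-trail : ∀ a l → l ≤ T.K a → OnTrail a (T.W a l)
    on-trail a l l≤K = fromℕ< (s≤s l≤K) , cong (T.W a) (toℕ-fromℕ< (s≤s l≤K))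

    Ed-ends-on : ∀ a l → l < T.K a → ∀ {x y} → Joins G (T.Ed a l) x y → OnTrail a x × OnTrail a y
    Ed-ends-on a l l<K x~y with Joins-unique x~y (T.Ed-joins a l)
    ... | inj₁ (refl , refl) = on-trail a l (<⇒≤ l<K) , on-trail a (suc l) l<K
    ... | inj₂ (refl , refl) = on-trail a (suc l) l<K , on-trail a l (<⇒≤ l<K)

    inner-edge : ∀ a (i : Fin (suc (T.K a))) → toℕ i ≢ 0 → toℕ i ≢ T.K a → ∀ {e} → Incident G e (T.W a (toℕ i)) →
                 ∃ λ l → l < T.K a × e ≡ T.Ed a l
    inner-edge a i i≢0 i≢K e-at with T.inner-incident a (toℕ i) (n≢0⇒n>0 i≢0) i<K _ e-at
      where i<K = ≤∧≢⇒< (≤-pred (toℕ<n i)) i≢K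
    ... | inj₁ e≡ = pred (toℕ i) , subst (_≤ T.K a) (sym (suc-pred (toℕ i) {{≢-nonZero i≢0}})) (≤-pred (toℕ<n i)) , e≡
    ... | inj₂ e≡ = toℕ i , ≤∧≢⇒< (≤-pred (toℕ<n i)) i≢K , e≡

    trail-edges : ∀ a {Q : Fin (m G) → Set} →
      (∀ {e} → Incident G e u → Q e) → (∀ {e} → Incident G e (T.W a (T.K a)) → Q e) → (∀ l → l < T.K a → Q (T.Ed a l)) →
      ∀ i {e} → Incident G e (T.W a (toℕ i)) → Q e
    trail-edges a {Q} at-u at-end on-trail i {e} e-at with toℕ i ≟ 0 | toℕ i ≟ T.K a
    ... | yes i≡0 | _ = at-u (subst (Incident G e ∘ T.W a) i≡0 e-at)
    ... | no _ | yes i≡K = at-end (subst (Incident G e ∘ T.W a) i≡K e-at)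
    ... | no i≢0 | no i≢K with l , l<K , refl ← inner-edge a i i≢0 i≢K e-at = on-trail l l<K

    edge-index : ∀ a l → l < T.K a → ∃ λ (j : Fin (T.K a)) → T.Ed a (toℕ j) ≡ T.Ed a l
    edge-index a l l<K = fromℕ< l<K , cong (T.Ed a) (toℕ-fromℕ< l<K)

    trail-Ed-injective : ∀ a → Injection (T.Ed a ∘ toℕ)
    trail-Ed-injective a {j} {j′} e = toℕ-injective (T.Ed-injective a _ _ (toℕ<n j) (toℕ<n j′) e)

    trails-disjoint : ∀ a b → ¬ Pair.SameTrail a b → ∀ (j : Fin (T.K a)) (j′ : Fin (T.K b)) → T.Ed a (toℕ j) ≢ T.Ed b (toℕ j′)
    trails-disjoint a b different j j′ e = different (Pair.shared-edge⇒same a b (toℕ j′) (toℕ j) (toℕ<n j′) (toℕ<n j) (sym e))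

    -- A trail a that returns to u along dart b cuts the remaining dart c of u off the rest of G.
    returning-trail : ∀ a b c → c ≢ a → c ≢ b → T.W a (T.K a) ≡ u → T.Ed a (pred (T.K a)) ≡ darts b →
      (∀ {e} → Incident G e u → e ≡ darts a ⊎ e ≡ darts b ⊎ e ≡ darts c) → ⊥
    returning-trail a b c c≢a c≢b returns last≡b three =
      NoBridge.not-dense G connected on-a? (T.Ed-joins c 0) (zero , refl) beyond-c stays m≡ dense
      where
      on-a? : ∀ w → Dec (OnTrail a w)
      on-a? w = any? λ i → T.W a (toℕ i) F.≟ w
      different : ¬ Pair.SameTrail a c
      different (inj₁ (_ , e)) = c≢a (darts-injective e)
      different (inj₂ (_ , e)) = c≢b (darts-injective (trans e last≡b))
      at-u : ∀ {i x y} → x ≡ u → i ≢ darts c → Joins G i x y → OnTrail a y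
      at-u {i} {x} {y} refl i≢c x~y with three (Joins⇒Incidentˡ x~y)
      ... | inj₁ refl = proj₂ (Ed-ends-on a 0 (T.1≤K a) x~y)
      ... | inj₂ (inj₁ i≡b) = proj₂ (Ed-ends-on a (pred (T.K a)) (T.pred-K<K a) (subst (λ t → Joins G t x y) (trans i≡b (sym last≡b)) x~y))
      ... | inj₂ (inj₂ i≡c) = contradiction i≡c i≢c
      stays : ∀ {i x y} → i ≢ darts c → Joins G i x y → OnTrail a x → OnTrail a y
      stays {i} i≢c x~y (j , refl) with toℕ j ≟ 0 | toℕ j ≟ T.K a
      ... | yes j≡0 | _ = at-u (cong (T.W a) j≡0) i≢c x~y
      ... | no _ | yes j≡K = at-u (trans (cong (T.W a) j≡K) returns) i≢c x~y
      ... | no j≢0 | no j≢K with l , l<K , refl ← inner-edge a j j≢0 j≢K (Joins⇒Incidentˡ x~y) = proj₂ (Ed-ends-on a l l<K x~y)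
      beyond-c : ¬ OnTrail a (T.W c 1)
      beyond-c (j , eq) with toℕ j ≟ 0 | toℕ j ≟ T.K a
      ... | yes j≡0 | _ = no-loop (proj₁ simple) (subst (Joins G (darts c) u) (trans (sym eq) (cong (T.W a) j≡0)) (T.Ed-joins c 0))
      ... | no _ | yes j≡K = no-loop (proj₁ simple) (subst (Joins G (darts c) u) (trans (sym eq) (trans (cong (T.W a) j≡K) returns)) (T.Ed-joins c 0))
      ... | no j≢0 | no j≢K with T.K c ≟ 1
      ...   | yes K≡1 = T.stops-at-K c (subst Through (trans eq (cong (T.W c) (sym K≡1)))
                            (T.through-before-K a (toℕ j) (n≢0⇒n>0 j≢0) (≤∧≢⇒< (≤-pred (toℕ<n j)) j≢K)))
      ...   | no K≢1 = different (Pair.shared-inner⇒same a c (toℕ j) 1 (n≢0⇒n>0 j≢0) (≤∧≢⇒< (≤-pred (toℕ<n j)) j≢K) ≤-refl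
                          (≤∧≢⇒< (T.1≤K c) (K≢1 ∘ sym)) eq)

  module TwoBranches {u v : Fin (n G)} (u≢v : u ≢ v) (deg-u : deg u ≡ 3) (deg-v : deg v ≡ 3)
                     (others : ∀ x → x ≢ u → x ≢ v → Through x) where
    u-stops : ¬ Through u
    u-stops through = contradiction (trans (sym deg-u) through) λ ()

    open FromBranch u-stops deg-u
    module V = DartsOf v deg-v

    stops-at-u-or-v : ∀ x → ¬ Through x → x ≡ u ⊎ x ≡ v
    stops-at-u-or-v x stops with x F.≟ u | x F.≟ v
    ... | yes x≡u | _ = inj₁ x≡u
    ... | no _ | yes x≡v = inj₂ x≡v
    ... | no x≢u | no x≢v = contradiction (others x x≢u x≢v) stops

    abstract
      ends-at-v : ∀ a → T.W a (T.K a) ≡ v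
      ends-at-v a with stops-at-u-or-v _ (T.stops-at-K a)
      ... | inj₂ at-v = at-v
      ... | inj₁ at-u with b , last≡b ← darts-onto (subst (Incident G _) at-u (T.last-incident a))
        = ⊥-elim (returning-trail a b c c≢a c≢b at-u (sym last≡b) three)
        where
        b≢a : b ≢ a
        b≢a refl = T.closed⇒last≢first a at-u (sym last≡b)
        c : Fin 3
        c = proj₁ (third a b (b≢a ∘ sym))
        c≢a : c ≢ a
        c≢a = proj₁ (proj₂ (third a b (b≢a ∘ sym)))
        c≢b : c ≢ b
        c≢b = proj₂ (proj₂ (third a b (b≢a ∘ sym)))
        three : ∀ {e} → Incident G e u → e ≡ darts a ⊎ e ≡ darts b ⊎ e ≡ darts c
        three e-at-u with k , refl ← darts-onto e-at-u with cover₃ (b≢a ∘ sym) (c≢a ∘ sym) (c≢b ∘ sym) k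
        ... | inj₁ refl = inj₁ refl
        ... | inj₂ (inj₁ refl) = inj₂ (inj₁ refl)
        ... | inj₂ (inj₂ refl) = inj₂ (inj₂ refl)

    different : ∀ a b → a ≢ b → ¬ Pair.SameTrail a b
    different a b a≢b (inj₁ (_ , e)) = a≢b (darts-injective (sym e))
    different a b a≢b (inj₂ (u≡end , _)) = u≢v (trans u≡end (ends-at-v a))

    path : ∀ a → Path G u v
    path a = T.pathTo a (ends-at-v a)

    X Y Z : Path G u v
    X = path zero
    Y = path (suc zero)
    Z = path (suc (suc zero))

    Position : Set
    Position = Fin (len X) ⊎ Fin (len Y) ⊎ Fin (len Z)

    position : ∀ a → Fin (T.K a) → Position
    position zero = inj₁
    position (suc zero) = inj₂ ∘ inj₁
    position (suc (suc zero)) = inj₂ ∘ inj₂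

    position-edge : ∀ a j → EdgeOf3 X Y Z (position a j) ≡ T.Ed a (toℕ j)
    position-edge zero j = refl
    position-edge (suc zero) j = refl
    position-edge (suc (suc zero)) j = refl

    OnSomePath : Fin (m G) → Set
    OnSomePath e = ∃ λ p → EdgeOf3 X Y Z p ≡ e

    trail-edge : ∀ a l → l < T.K a → OnSomePath (T.Ed a l)
    trail-edge a l l<K with j , eq ← edge-index a l l<K = position a j , trans (position-edge a j) eq

    at-u : ∀ {e} → Incident G e u → OnSomePath e
    at-u e-at-u with a , refl ← darts-onto e-at-u = trail-edge a 0 (T.1≤K a)

    abstract
      last-dart : Fin 3 → Fin 3
      last-dart a = proj₁ (V.darts-onto (subst (Incident G _) (ends-at-v a) (T.last-incident a)))

      last-dart-edge : ∀ a → V.darts (last-dart a) ≡ T.Ed a (pred (T.K a))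
      last-dart-edge a = proj₂ (V.darts-onto (subst (Incident G _) (ends-at-v a) (T.last-incident a)))

    last-dart-injective : Injection last-dart
    last-dart-injective {a} {b} e with a F.≟ b
    ... | yes a≡b = a≡b
    ... | no a≢b = contradiction (Pair.shared-edge⇒same a b (pred (T.K b)) (pred (T.K a)) (T.pred-K<K b) (T.pred-K<K a) shared)
                                 (different a b a≢b)
      where shared = trans (sym (last-dart-edge b)) (trans (cong V.darts (sym e)) (last-dart-edge a))

    at-v : ∀ {e} → Incident G e v → OnSomePath e
    at-v e-at-v with k , refl ← V.darts-onto e-at-v with a , refl ← injective⇒onto last-dart last-dart-injective k =
      subst OnSomePath (sym (last-dart-edge a)) (trail-edge a (pred (T.K a)) (T.pred-K<K a))

    at-end : ∀ a {e} → Incident G e (T.W a (T.K a)) → OnSomePath e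
    at-end a = at-v ∘ subst (Incident G _) (ends-at-v a)

    on-trail-edges : ∀ a i {e} → Incident G e (T.W a (toℕ i)) → OnSomePath e
    on-trail-edges a = trail-edges a at-u (at-end a) (trail-edge a)

    closed : Closed X Y Z
    closed w (inj₁ (i , refl)) e = on-trail-edges zero i
    closed w (inj₂ (inj₁ (i , refl))) e = on-trail-edges (suc zero) i
    closed w (inj₂ (inj₂ (i , refl))) e = on-trail-edges (suc (suc zero)) i

    apart : ∀ a b → a ≢ b → ∀ j j′ → T.Ed a (toℕ j) ≢ T.Ed b (toℕ j′)
    apart a b a≢b = trails-disjoint a b (different a b a≢b)

    edges-injective : Injection (EdgeOf3 X Y Z)
    edges-injective {inj₁ j} {inj₁ j′} e = cong inj₁ (trail-Ed-injective zero e)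
    edges-injective {inj₂ (inj₁ j)} {inj₂ (inj₁ j′)} e = cong (inj₂ ∘ inj₁) (trail-Ed-injective (suc zero) e)
    edges-injective {inj₂ (inj₂ j)} {inj₂ (inj₂ j′)} e = cong (inj₂ ∘ inj₂) (trail-Ed-injective (suc (suc zero)) e)
    edges-injective {inj₁ j} {inj₂ (inj₁ j′)} e = contradiction e (apart zero (suc zero) (λ ()) j j′)
    edges-injective {inj₁ j} {inj₂ (inj₂ j′)} e = contradiction e (apart zero (suc (suc zero)) (λ ()) j j′)
    edges-injective {inj₂ (inj₁ j)} {inj₁ j′} e = contradiction e (apart (suc zero) zero (λ ()) j j′)
    edges-injective {inj₂ (inj₁ j)} {inj₂ (inj₂ j′)} e = contradiction e (apart (suc zero) (suc (suc zero)) (λ ()) j j′)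
    edges-injective {inj₂ (inj₂ j)} {inj₁ j′} e = contradiction e (apart (suc (suc zero)) zero (λ ()) j j′)
    edges-injective {inj₂ (inj₂ j)} {inj₂ (inj₁ j′)} e = contradiction e (apart (suc (suc zero)) (suc zero) (λ ()) j j′)

    theta : Theta G
    theta = record
      { u = u ; v = v ; X = X ; Y = Y ; Z = Z
      ; X∩Y = share zero (suc zero) (λ ())
      ; X∩Z = share zero (suc (suc zero)) (λ ())
      ; Y∩Z = share (suc zero) (suc (suc zero)) (λ ())
      ; covers = closed⇒covers X Y Z connected closed
      ; edges-onto = closed⇒onto X Y Z connected closed
      ; edges-injective = edges-injective }
      where
      share : ∀ a b → a ≢ b → ShareOnlyEnds (path a) (path b)
      share a b a≢b = Pair.share-only-ends a b (ends-at-v a) (ends-at-v b) (different a b a≢b)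

  module OneBranch {u : Fin (n G)} (deg-u : deg u ≡ 4) (others : ∀ x → x ≢ u → Through x) where
    u-stops : ¬ Through u
    u-stops through = contradiction (trans (sym deg-u) through) λ ()

    open FromBranch u-stops deg-u

    abstract
      ends-at-u : ∀ a → T.W a (T.K a) ≡ u
      ends-at-u a with T.W a (T.K a) F.≟ u
      ... | yes at-u = at-u
      ... | no ¬at-u = ⊥-elim (T.stops-at-K a (others _ ¬at-u))

      return-dart : Fin 4 → Fin 4
      return-dart a = proj₁ (darts-onto (subst (Incident G _) (ends-at-u a) (T.last-incident a)))

      return-dart-edge : ∀ a → darts (return-dart a) ≡ T.Ed a (pred (T.K a))
      return-dart-edge a = proj₂ (darts-onto (subst (Incident G _) (ends-at-u a) (T.last-incident a)))

    return-dart≢ : ∀ a → return-dart a ≢ a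
    return-dart≢ a e = T.closed⇒last≢first a (ends-at-u a) (trans (sym (return-dart-edge a)) (cong darts e))

    -- Trail 0 returns along dart b; any dart c other than 0 and b starts a second trail,
    -- which returns along a fourth dart e.
    b : Fin 4
    b = return-dart zero

    pick-c : (b : Fin 4) → b ≢ zero → ∃ λ c → c ≢ zero × c ≢ b
    pick-c zero b≢0 = contradiction refl b≢0
    pick-c (suc zero) _ = suc (suc zero) , (λ ()) , (λ ())
    pick-c (suc (suc zero)) _ = suc zero , (λ ()) , (λ ())
    pick-c (suc (suc (suc zero))) _ = suc zero , (λ ()) , (λ ())

    module Second (c : Fin 4) (c≢0 : c ≢ zero) (c≢b : c ≢ b) where
      0≠c : ¬ Pair.SameTrail zero c
      0≠c (inj₁ (_ , e)) = c≢0 (darts-injective e)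
      0≠c (inj₂ (_ , e)) = c≢b (darts-injective (trans e (sym (return-dart-edge zero))))

      e : Fin 4
      e = return-dart c

      e≢0 : e ≢ zero
      e≢0 e≡0 = 0≠c (Pair.shared-edge⇒same zero c (pred (T.K c)) 0 (T.pred-K<K c) (T.1≤K zero)
                       (trans (sym (return-dart-edge c)) (cong darts e≡0)))

      e≢b : e ≢ b
      e≢b e≡b = 0≠c (Pair.shared-edge⇒same zero c (pred (T.K c)) (pred (T.K zero)) (T.pred-K<K c) (T.pred-K<K zero)
                       (trans (sym (return-dart-edge c)) (trans (cong darts e≡b) (return-dart-edge zero))))

      c≠0 : ¬ Pair.SameTrail c zero
      c≠0 (inj₁ (_ , e′)) = c≢0 (sym (darts-injective e′))
      c≠0 (inj₂ (_ , e′)) = e≢0 (sym (darts-injective (trans e′ (sym (return-dart-edge c)))))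

      path : ∀ a → Path G u u
      path a = T.pathTo a (ends-at-u a)

      X Y Z : Path G u u
      X = trivial-path u
      Y = path zero
      Z = path c

      OnSomePath : Fin (m G) → Set
      OnSomePath e = ∃ λ p → EdgeOf3 X Y Z p ≡ e

      on-Y : ∀ l → l < T.K zero → OnSomePath (T.Ed zero l)
      on-Y l l<K with j , eq ← edge-index zero l l<K = inj₂ (inj₁ j) , eq

      on-Z : ∀ l → l < T.K c → OnSomePath (T.Ed c l)
      on-Z l l<K with j , eq ← edge-index c l l<K = inj₂ (inj₂ j) , eq

      dart-on-path : ∀ {k} → k ≡ zero ⊎ k ≡ b ⊎ k ≡ c ⊎ k ≡ e → OnSomePath (darts k)
      dart-on-path (inj₁ refl) = on-Y 0 (T.1≤K zero)
      dart-on-path (inj₂ (inj₁ refl)) = subst OnSomePath (sym (return-dart-edge zero)) (on-Y (pred (T.K zero)) (T.pred-K<K zero))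
      dart-on-path (inj₂ (inj₂ (inj₁ refl))) = on-Z 0 (T.1≤K c)
      dart-on-path (inj₂ (inj₂ (inj₂ refl))) = subst OnSomePath (sym (return-dart-edge c)) (on-Z (pred (T.K c)) (T.pred-K<K c))

      at-u : ∀ {e′} → Incident G e′ u → OnSomePath e′
      at-u e′-at-u with k , k-edge ← darts-onto e′-at-u =
        subst OnSomePath k-edge (dart-on-path (cover₄ (return-dart≢ zero ∘ sym) (c≢0 ∘ sym) (e≢0 ∘ sym) (c≢b ∘ sym) (e≢b ∘ sym) (return-dart≢ c ∘ sym) k))

      on-trail-edges : ∀ a → (∀ l → l < T.K a → OnSomePath (T.Ed a l)) → ∀ i {e′} → Incident G e′ (T.W a (toℕ i)) → OnSomePath e′
      on-trail-edges a on-a = trail-edges a at-u (at-u ∘ subst (Incident G _) (ends-at-u a)) on-a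

      closed : Closed X Y Z
      closed w (inj₁ (zero , refl)) _ = at-u
      closed w (inj₂ (inj₁ (i , refl))) _ = on-trail-edges zero on-Y i
      closed w (inj₂ (inj₂ (i , refl))) _ = on-trail-edges c on-Z i

      edges-injective : Injection (EdgeOf3 X Y Z)
      edges-injective {inj₂ (inj₁ j)} {inj₂ (inj₁ j′)} e′ = cong (inj₂ ∘ inj₁) (trail-Ed-injective zero e′)
      edges-injective {inj₂ (inj₂ j)} {inj₂ (inj₂ j′)} e′ = cong (inj₂ ∘ inj₂) (trail-Ed-injective c e′)
      edges-injective {inj₂ (inj₁ j)} {inj₂ (inj₂ j′)} e′ = contradiction e′ (trails-disjoint zero c 0≠c j j′)
      edges-injective {inj₂ (inj₂ j)} {inj₂ (inj₁ j′)} e′ = contradiction e′ (trails-disjoint c zero c≠0 j j′)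

      theta : Theta G
      theta = record
        { u = u ; v = u ; X = X ; Y = Y ; Z = Z
        ; X∩Y = λ { w (zero , refl) _ → inj₁ refl }
        ; X∩Z = λ { w (zero , refl) _ → inj₁ refl }
        ; Y∩Z = Pair.share-only-ends zero c (ends-at-u zero) (ends-at-u c) 0≠c
        ; covers = closed⇒covers X Y Z connected closed
        ; edges-onto = closed⇒onto X Y Z connected closed
        ; edges-injective = edges-injective }

    theta : Theta G
    theta = Second.theta c c≢0 c≢b
      where
      c-choice = pick-c b (return-dart≢ zero)
      c = proj₁ c-choice
      c≢0 = proj₁ (proj₂ c-choice)
      c≢b = proj₂ (proj₂ c-choice)

  -- the excess degrees sum to 2: one vertex of degree 4 or two of degree 3
  theta : Theta G
  theta with sum≡2⇒ excess sum-excess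
  ... | inj₁ (u , two , rest) = OneBranch.theta (deg-with u two) λ x x≢u → deg-with x (rest x x≢u)
  ... | inj₂ (u , v , u≢v , one , one′ , rest) =
    TwoBranches.theta u≢v (deg-with u one) (deg-with v one′) λ x x≢u x≢v → deg-with x (rest x x≢u x≢v)

UniformlyDense⇒ThetaBalanced : ∀ G → Simple G → Connected G → m G ≡ suc (n G) → UniformlyDense G → ThetaBalanced G
UniformlyDense⇒ThetaBalanced G simple connected m≡ dense =
  Balanced⇒ThetaBalanced t (Sorted⇒Balanced connected m≡ dense t sorted)
  where
  open DenseGraph G simple connected m≡ dense using (theta)
  t = proj₁ (sort theta)
  sorted = proj₂ (sort theta)

theorem3p10 : (G : Graph) → Simple G → Connected G →
    m G + 1 ≡ n G + 2 →
    UniformlyDense G ⇔ ThetaBalanced G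
theorem3p10 G simple connected m+1≡n+2 =
  mk⇔ (UniformlyDense⇒ThetaBalanced G simple connected m≡)
      (uncurry (Balanced⇒UniformlyDense m≡) ∘ ThetaBalanced⇒Balanced)
  where
  m≡ : m G ≡ suc (n G)
  m≡ = +-cancelʳ-≡ 1 (m G) (suc (n G)) (trans m+1≡n+2 (+-suc (n G) 1))
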